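{- Let $L$ be a nonempty multiset of even integers greater than $2$. If $\epsilon\ge 2(|L|+1)(\max(L)+3)-1$, then there is an $\alpha$-labeling $\Gamma$ of $\left[L\ \middle|\ \epsilon-\sum_{\ell\in L}\ell\right]$ such that $\Delta_p\Gamma\supseteq\mathcal{I}\big(2|L|(\max(L)+3),\,\epsilon\big)$.
   Context: $\mathcal{I}(a,b)=\{x\in\mathbb{Z}\mid a\le x\le b\}$; $|L|$ counts multiplicity. For a multiset $L$ of integers $\ge 2$ and $m\ge 0$, $[L\mid m]$ is the vertex-disjoint union of one $\ell$-cycle for each $\ell\in L$ and a path with $m$ edges; its number of edges is $\epsilon=\sum_{\ell\in L}\ell+m$. A labeling is an isomorphic copy with distinct integer vertices; $\Delta\Gamma$ is the multiset of differences $x-y$ over ordered pairs of adjacent vertices, and $\Delta_p\Gamma$ is the same multiset restricted to edges of the path component. An $\alpha$-labeling of such a bipartite graph with $\epsilon$ edges is a labeling $\Gamma$ with vertex set $\mathcal{I}(0,\epsilon)$ such that every edge joins a vertex of $\mathcal{I}(0,\lfloor(\epsilon-1)/2\rfloor)$ to a vertex of $\mathcal{I}(\lfloor(\epsilon+1)/2\rfloor,\epsilon)$ and $\Delta\Gamma=\pm\mathcal{I}(1,\epsilon)$. -}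

module Defs where

open import Data.Nat using (ℕ; zero; suc; _+_; _*_; _∸_; _≤_; _<_; _⊔_; _/_)
open import Data.Nat.Divisibility using (_∣_)
open import Data.Integer as ℤ using (ℤ; +_)
open import Data.List using (List; []; _∷_; _++_; [_]; length; map; concat; concatMap; foldr; upTo)
open import Data.Nat.ListAction using (sum)
open import Data.List.Relation.Unary.All using (All)
open import Data.List.Relation.Binary.Permutation.Propositional using (_↭_)
open import Data.Product using (_×_; _,_; proj₁; proj₂)
open import Relation.Binary.PropositionalEquality using (_≡_)

Iℕ : ℕ → ℕ → List ℕ
Iℕ a b = map (λ k → a + k) (upTo (suc b ∸ a))

pmI : ℕ → List ℤ
pmI ε = concatMap (λ k → (+ k) ∷ ℤ.- (+ k) ∷ []) (Iℕ 1 ε)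

consecutive : List ℕ → List (ℕ × ℕ)
consecutive []           = []
consecutive (x ∷ [])     = []
consecutive (x ∷ y ∷ xs) = (x , y) ∷ consecutive (y ∷ xs)

cycleEdges : List ℕ → List (ℕ × ℕ)
cycleEdges []       = []
cycleEdges (x ∷ xs) = consecutive (x ∷ xs ++ [ x ])

Δ : List (ℕ × ℕ) → List ℤ
Δ = concatMap (λ e → ((+ proj₁ e) ℤ.- (+ proj₂ e)) ∷ ((+ proj₂ e) ℤ.- (+ proj₁ e)) ∷ [])

-- A labeling of [L | m] with labels in ℕ: one vertex list per cycle
-- (in cyclic order) and the vertex list of the path (in path order).
record Labeling (L : List ℕ) (m : ℕ) : Set where
  field
    cycles    : List (List ℕ)
    cycleLens : map length cycles ≡ L
    path      : List ℕ
    pathLen   : length path ≡ suc m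

  vertices : List ℕ
  vertices = concat cycles ++ path

  edges : List (ℕ × ℕ)
  edges = concatMap cycleEdges cycles ++ consecutive path

  ΔΓ : List ℤ
  ΔΓ = Δ edges

  Δp : List ℤ
  Δp = Δ (consecutive path)

open Labeling public

Low : ℕ → ℕ → Set
Low ε x = x ≤ (ε ∸ 1) / 2

High : ℕ → ℕ → Set
High ε x = (suc ε) / 2 ≤ x

JoinsSides : ℕ → ℕ × ℕ → Set
JoinsSides ε (x , y) = (Low ε x × High ε y) Data.Sum.⊎ (Low ε y × High ε x)
  where import Data.Sum

-- α-labeling of [L | m], whose edge number is ε = sum L + m
record IsαLabeling {L : List ℕ} {m : ℕ} (Γ : Labeling L m) : Set where
  field
    vertexSet : vertices Γ ↭ Iℕ 0 (sum L + m)     -- distinct labels, vertex set I(0,ε)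
    bipartite : All (JoinsSides (sum L + m)) (edges Γ)
    differences : ΔΓ Γ ↭ pmI (sum L + m)

maxL : List ℕ → ℕ
maxL = foldr _⊔_ 0

module Submission where

-- Start from the α-labelling 1–2–0–3 of a path with 3 edges.  An α-labelling with ε edges
-- grows by p + q edges if its labels are shifted up by p, the small labels 0, …, p − 1 and
-- the large labels ε + p + 1, …, ε + p + q are added, and new cycles and a new initial
-- segment of the path, all of whose edges join a new small to a new large label, supply the
-- lengths ε + 1, …, ε + p + q.  Explicit ladder-shaped extensions add one cycle of any length
-- ℓ ≡ 0, 2 (mod 4), ℓ > 2, at a cost of at most (3ℓ + 4)/2 edges.  Once all cycles are
-- placed, path-only extensions of 4, 6 and 3 edges reach every ε beyond the bound, and every
-- length they create, in particular every length above 2|L|(max L + 3), lies on the path.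

open import Defs
open import Data.Nat using (ℕ; zero; suc; _+_; _*_; _∸_; _≤_; _<_; _>_; z≤n; s≤s; _≟_; _≤?_; ∣_-_∣)
open import Data.Nat.Properties
open import Data.Nat.Divisibility using (_∣_; divides)
open import Data.Nat.DivMod using (_/_; _%_; m/n≡1+[m∸n]/n; m≡m%n+[m/n]*n; m%n<n)
open import Data.Nat.ListAction using (sum)
open import Data.Nat.Tactic.RingSolver using (solve-∀)
open import Data.Integer as ℤ using (ℤ)
import Data.Integer.Properties as ℤₚ
open import Data.List using (List; []; _∷_; _++_; [_]; length; map; concat; concatMap; reverse; applyUpTo)
open import Data.List.Properties
  using (map-++; length-map; length-++; length-reverse; reverse-++; reverse-map; ++-assoc; ++-identityʳ;
         map-∘; map-cong; map-cong-local; map-id; concat-map; concat-++; concatMap-++; concatMap-cong; unfold-reverse)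
open import Data.List.Relation.Binary.Permutation.Propositional
  using (_↭_; ↭-refl; ↭-sym; ↭-trans; ↭-prep; ↭-swap; ↭-reflexive; module PermutationReasoning)
import Data.List.Relation.Binary.Permutation.Propositional as Perm
open import Data.List.Relation.Binary.Permutation.Propositional.Properties
  using (map⁺; ++⁺; ++⁺ˡ; ++⁺ʳ; ↭-length; ↭-reverse; shift; shifts; ∈-resp-↭; All-resp-↭; ∷↭∷ʳ)
  renaming (++-comm to ↭-++-comm)
open import Data.List.Relation.Unary.All as All using (All; []; _∷_)
import Data.List.Relation.Unary.All.Properties as All
open import Data.List.Relation.Unary.Any using (here; there)
open import Data.List.Membership.Propositional using (_∈_)
open import Data.List.Membership.Propositional.Properties using (∈-++⁻; ∈-++⁺ˡ; ∈-++⁺ʳ)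
open import Data.Maybe using (Maybe; just; nothing; Is-just; to-witness)
import Data.Maybe.Relation.Unary.Any as Maybe
open import Data.Product as Product using (Σ; ∃; _×_; _,_; proj₁; proj₂; swap)
open import Data.Sum using (_⊎_; inj₁; inj₂)
open import Data.Unit using (⊤; tt)
open import Data.Empty using (⊥; ⊥-elim)
open import Function using (id; _∘_)
open import Relation.Binary.Definitions using (DecidableEquality)
open import Relation.Binary.PropositionalEquality
  using (_≡_; _≢_; refl; sym; trans; cong; cong₂; subst; module ≡-Reasoning)
open import Relation.Nullary using (yes; no)

-- Intervals of naturals

range : ℕ → ℕ → List ℕ
range a zero    = []
range a (suc n) = a ∷ range (suc a) n

range-++ : ∀ a m n → range a (m + n) ≡ range a m ++ range (a + m) n
range-++ a zero    n = cong (λ b → range b n) (sym (+-identityʳ a))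
range-++ a (suc m) n =
  cong (a ∷_) (trans (range-++ (suc a) m n) (cong (λ b → range (suc a) m ++ range b n) (sym (+-suc a m))))

length-range : ∀ a n → length (range a n) ≡ n
length-range a zero    = refl
length-range a (suc n) = cong suc (length-range (suc a) n)

map-+-range : ∀ p a n → map (p +_) (range a n) ≡ range (p + a) n
map-+-range p a zero    = refl
map-+-range p a (suc n) =
  cong ((p + a) ∷_) (trans (map-+-range p (suc a) n) (cong (λ b → range b n) (+-suc p a)))

map-∸-range : ∀ m k n b → b + n + k ≡ m → map (m ∸_) (range k n) ↭ range (suc b) n
map-∸-range m k zero    b eq = ↭-refl
map-∸-range m k (suc n) b eq = begin
  m ∸ k ∷ map (m ∸_) (range (suc k) n) ↭⟨ ↭-prep (m ∸ k) (map-∸-range m (suc k) n b eq′) ⟩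
  m ∸ k ∷ range (suc b) n              ↭⟨ ∷↭∷ʳ (m ∸ k) (range (suc b) n) ⟩
  range (suc b) n ++ [ m ∸ k ]         ≡⟨ cong (λ z → range (suc b) n ++ [ z ]) m∸k≡ ⟩
  range (suc b) n ++ [ suc b + n ]     ≡⟨ sym (range-++ (suc b) n 1) ⟩
  range (suc b) (n + 1)                ≡⟨ cong (range (suc b)) (+-comm n 1) ⟩
  range (suc b) (suc n)                ∎
  where
  open PermutationReasoning
  eq′ : b + n + suc k ≡ m
  eq′ = trans (trans (+-suc (b + n) k) (cong (_+ k) (sym (+-suc b n)))) eq
  m∸k≡ : m ∸ k ≡ suc b + n
  m∸k≡ = trans (cong (_∸ k) (sym eq)) (trans (m+n∸n≡m (b + suc n) k) (+-suc b n))

∈-range⁻ : ∀ {k} a n → k ∈ range a n → a ≤ k × k < a + n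
∈-range⁻ a (suc n) (here refl) = ≤-refl , subst (a <_) (sym (+-suc a n)) (s≤s (m≤m+n a n))
∈-range⁻ {k} a (suc n) (there k∈) =
  Product.map <⇒≤ (subst (k <_) (sym (+-suc a n))) (∈-range⁻ (suc a) n k∈)

∈-range⁺ : ∀ {k} a n → a ≤ k → k < a + n → k ∈ range a n
∈-range⁺ a zero    a≤k k< = ⊥-elim (<-irrefl refl (subst (a <_) (+-identityʳ a) (≤-<-trans a≤k k<)))
∈-range⁺ {k} a (suc n) a≤k k< with a ≟ k
... | yes refl = here refl
... | no  a≢k  = there (∈-range⁺ (suc a) n (≤∧≢⇒< a≤k a≢k) (subst (k <_) (+-suc a n) k<))

applyUpTo-range : ∀ (f : ℕ → ℕ) a n → (∀ k → f k ≡ a + k) → applyUpTo f n ≡ range a n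
applyUpTo-range f a zero    f≡ = refl
applyUpTo-range f a (suc n) f≡ = cong₂ _∷_ (trans (f≡ 0) (+-identityʳ a))
  (applyUpTo-range (λ k → f (suc k)) (suc a) n (λ k → trans (f≡ (suc k)) (+-suc a k)))

map-applyUpTo : ∀ (f g : ℕ → ℕ) n → map f (applyUpTo g n) ≡ applyUpTo (λ k → f (g k)) n
map-applyUpTo f g zero    = refl
map-applyUpTo f g (suc n) = cong (f (g 0) ∷_) (map-applyUpTo f (λ k → g (suc k)) n)

Iℕ≡range : ∀ a b → Iℕ a b ≡ range a (suc b ∸ a)
Iℕ≡range a b = trans (map-applyUpTo (a +_) id (suc b ∸ a)) (applyUpTo-range (a +_) a (suc b ∸ a) (λ _ → refl))

-- Paths and cycles as vertex lists

module _ {A : Set} where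

  edgesAlong : List A → List (A × A)
  edgesAlong []           = []
  edgesAlong (x ∷ [])     = []
  edgesAlong (x ∷ y ∷ xs) = (x , y) ∷ edgesAlong (y ∷ xs)

  edgesAround : List A → List (A × A)
  edgesAround []       = []
  edgesAround (x ∷ xs) = edgesAlong (x ∷ xs ++ [ x ])

  edgesAlong-++ : ∀ xs (a : A) ys → edgesAlong (xs ++ a ∷ ys) ≡ edgesAlong (xs ++ [ a ]) ++ edgesAlong (a ∷ ys)
  edgesAlong-++ []           a ys = refl
  edgesAlong-++ (x ∷ [])     a ys = refl
  edgesAlong-++ (x ∷ y ∷ xs) a ys = cong ((x , y) ∷_) (edgesAlong-++ (y ∷ xs) a ys)

  edgesAlong-snoc : ∀ (a : A) as b → edgesAlong (reverse (a ∷ as) ++ [ b ]) ≡ edgesAlong (reverse (a ∷ as)) ++ [ (a , b) ]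
  edgesAlong-snoc a as b = begin
    edgesAlong (reverse (a ∷ as) ++ [ b ])          ≡⟨ cong (λ z → edgesAlong (z ++ [ b ])) (unfold-reverse a as) ⟩
    edgesAlong ((reverse as ++ [ a ]) ++ [ b ])     ≡⟨ cong edgesAlong (++-assoc (reverse as) [ a ] [ b ]) ⟩
    edgesAlong (reverse as ++ a ∷ [ b ])            ≡⟨ edgesAlong-++ (reverse as) a [ b ] ⟩
    edgesAlong (reverse as ++ [ a ]) ++ [ (a , b) ] ≡⟨ cong (λ z → edgesAlong z ++ [ (a , b) ]) (unfold-reverse a as) ⟨
    edgesAlong (reverse (a ∷ as)) ++ [ (a , b) ]    ∎
    where open ≡-Reasoning

  edgesAlong-reverse : ∀ (a : A) as → edgesAlong (reverse (a ∷ as)) ↭ map swap (edgesAlong (a ∷ as))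
  edgesAlong-reverse a []        = ↭-refl
  edgesAlong-reverse a (b ∷ as) = begin
    edgesAlong (reverse (a ∷ b ∷ as))                         ≡⟨ cong edgesAlong (unfold-reverse a (b ∷ as)) ⟩
    edgesAlong (reverse (b ∷ as) ++ [ a ])                    ≡⟨ edgesAlong-snoc b as a ⟩
    edgesAlong (reverse (b ∷ as)) ++ [ (b , a) ]              ↭⟨ ++⁺ʳ _ (edgesAlong-reverse b as) ⟩
    map swap (edgesAlong (b ∷ as)) ++ [ (b , a) ]             ↭⟨ ∷↭∷ʳ (b , a) _ ⟨
    map swap (edgesAlong (a ∷ b ∷ as))                        ∎
    where open PermutationReasoning

  edgesAlong-reverse-++ : ∀ (a : A) as b bs →
    edgesAlong (reverse (a ∷ as) ++ b ∷ bs) ↭ map swap (edgesAlong (a ∷ as)) ++ (a , b) ∷ edgesAlong (b ∷ bs)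
  edgesAlong-reverse-++ a as b bs = begin
    edgesAlong (reverse (a ∷ as) ++ b ∷ bs)                            ≡⟨ edgesAlong-++ (reverse (a ∷ as)) b bs ⟩
    edgesAlong (reverse (a ∷ as) ++ [ b ]) ++ edgesAlong (b ∷ bs)      ≡⟨ cong (_++ edgesAlong (b ∷ bs)) (edgesAlong-snoc a as b) ⟩
    (edgesAlong (reverse (a ∷ as)) ++ [ (a , b) ]) ++ edgesAlong (b ∷ bs) ≡⟨ ++-assoc (edgesAlong (reverse (a ∷ as))) _ _ ⟩
    edgesAlong (reverse (a ∷ as)) ++ (a , b) ∷ edgesAlong (b ∷ bs)     ↭⟨ ++⁺ʳ _ (edgesAlong-reverse a as) ⟩
    map swap (edgesAlong (a ∷ as)) ++ (a , b) ∷ edgesAlong (b ∷ bs)    ∎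
    where open PermutationReasoning

  edgesAlong-glue : ∀ (as : List A) b bs →
    edgesAlong (reverse as ++ b ∷ bs) ↭ map swap (edgesAlong (b ∷ as)) ++ edgesAlong (b ∷ bs)
  edgesAlong-glue []       b bs = ↭-refl
  edgesAlong-glue (a ∷ as) b bs =
    ↭-trans (edgesAlong-reverse-++ a as b bs) (shift (a , b) (map swap (edgesAlong (a ∷ as))) (edgesAlong (b ∷ bs)))

  ∈-edgesAlong⁻ : ∀ xs {e : A × A} → e ∈ edgesAlong xs → proj₁ e ∈ xs × proj₂ e ∈ xs
  ∈-edgesAlong⁻ (x ∷ y ∷ xs) (here refl) = here refl , there (here refl)
  ∈-edgesAlong⁻ (x ∷ y ∷ xs) (there e∈)  = Product.map there there (∈-edgesAlong⁻ (y ∷ xs) e∈)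

  ∈-edgesAround⁻ : ∀ xs {e : A × A} → e ∈ edgesAround xs → proj₁ e ∈ xs × proj₂ e ∈ xs
  ∈-edgesAround⁻ (x ∷ xs) e∈ = Product.map closing closing (∈-edgesAlong⁻ (x ∷ xs ++ [ x ]) e∈)
    where
    closing : ∀ {y} → y ∈ x ∷ xs ++ [ x ] → y ∈ x ∷ xs
    closing y∈ with ∈-++⁻ (x ∷ xs) y∈
    ... | inj₁ y∈′        = y∈′
    ... | inj₂ (here refl) = here refl

  ∈-concatMap-edgesAround⁻ : ∀ xss {e : A × A} → e ∈ concatMap edgesAround xss → proj₁ e ∈ concat xss × proj₂ e ∈ concat xss
  ∈-concatMap-edgesAround⁻ (xs ∷ xss) e∈ with ∈-++⁻ (edgesAround xs) e∈
  ... | inj₁ e∈′ = Product.map ∈-++⁺ˡ ∈-++⁺ˡ (∈-edgesAround⁻ xs e∈′)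
  ... | inj₂ e∈′ = Product.map (∈-++⁺ʳ xs) (∈-++⁺ʳ xs) (∈-concatMap-edgesAround⁻ xss e∈′)

  length-edgesAlong : ∀ (y : A) ys → length (edgesAlong (y ∷ ys)) ≡ length ys
  length-edgesAlong y []       = refl
  length-edgesAlong y (z ∷ zs) = cong suc (length-edgesAlong z zs)

  length-edgesAround : ∀ (xs : List A) → length (edgesAround xs) ≡ length xs
  length-edgesAround []       = refl
  length-edgesAround (x ∷ xs) = trans (length-edgesAlong x (xs ++ [ x ])) (trans (length-++ xs) (+-comm (length xs) 1))

  length-concatMap-edgesAround : ∀ (xss : List (List A)) → length (concatMap edgesAround xss) ≡ sum (map length xss)
  length-concatMap-edgesAround []         = refl
  length-concatMap-edgesAround (xs ∷ xss) =
    trans (length-++ (edgesAround xs)) (cong₂ _+_ (length-edgesAround xs) (length-concatMap-edgesAround xss))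

  length-concat : ∀ (xss : List (List A)) → length (concat xss) ≡ sum (map length xss)
  length-concat []         = refl
  length-concat (xs ∷ xss) = trans (length-++ xs) (cong (length xs +_) (length-concat xss))

onBoth : {A B : Set} → (A → B) → A × A → B × B
onBoth f = Product.map f f

module _ {A B : Set} (f : A → B) where

  edgesAlong-map : ∀ xs → map (onBoth f) (edgesAlong xs) ≡ edgesAlong (map f xs)
  edgesAlong-map []           = refl
  edgesAlong-map (x ∷ [])     = refl
  edgesAlong-map (x ∷ y ∷ xs) = cong ((f x , f y) ∷_) (edgesAlong-map (y ∷ xs))

  edgesAround-map : ∀ xs → map (onBoth f) (edgesAround xs) ≡ edgesAround (map f xs)
  edgesAround-map []       = refl
  edgesAround-map (x ∷ xs) = trans (edgesAlong-map (x ∷ xs ++ [ x ])) (cong (λ z → edgesAlong (f x ∷ z)) (map-++ f xs [ x ]))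

  concatMap-edgesAround-map : ∀ xss → concatMap edgesAround (map (map f) xss) ≡ map (onBoth f) (concatMap edgesAround xss)
  concatMap-edgesAround-map []         = refl
  concatMap-edgesAround-map (xs ∷ xss) =
    trans (cong₂ _++_ (sym (edgesAround-map xs)) (concatMap-edgesAround-map xss)) (sym (map-++ (onBoth f) (edgesAround xs) _))

consecutive≡edgesAlong : ∀ xs → consecutive xs ≡ edgesAlong xs
consecutive≡edgesAlong []           = refl
consecutive≡edgesAlong (x ∷ [])     = refl
consecutive≡edgesAlong (x ∷ y ∷ xs) = cong ((x , y) ∷_) (consecutive≡edgesAlong (y ∷ xs))

cycleEdges≡edgesAround : ∀ xs → cycleEdges xs ≡ edgesAround xs
cycleEdges≡edgesAround []       = refl
cycleEdges≡edgesAround (x ∷ xs) = consecutive≡edgesAlong (x ∷ xs ++ [ x ])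

↭-interchange : ∀ {A : Set} (a b c d : List A) → (a ++ b) ++ (c ++ d) ↭ (a ++ c) ++ (b ++ d)
↭-interchange a b c d = begin
  (a ++ b) ++ (c ++ d) ≡⟨ ++-assoc a b (c ++ d) ⟩
  a ++ (b ++ c ++ d)   ↭⟨ ++⁺ˡ a (shifts b c) ⟩
  a ++ (c ++ b ++ d)   ≡⟨ ++-assoc a c (b ++ d) ⟨
  (a ++ c) ++ (b ++ d) ∎
  where open PermutationReasoning

concatMap⁺ : ∀ {A B : Set} (f : A → List B) {xs ys} → xs ↭ ys → concatMap f xs ↭ concatMap f ys
concatMap⁺ f Perm.refl                 = ↭-refl
concatMap⁺ f (Perm.prep x xs↭ys)       = ++⁺ˡ (f x) (concatMap⁺ f xs↭ys)
concatMap⁺ f (Perm.swap x y xs↭ys)     = ↭-trans (shifts (f x) (f y)) (++⁺ˡ (f y) (++⁺ˡ (f x) (concatMap⁺ f xs↭ys)))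
concatMap⁺ f (Perm.trans xs↭ys ys↭zs) = ↭-trans (concatMap⁺ f xs↭ys) (concatMap⁺ f ys↭zs)

map-map-cong : ∀ {A B C : Set} {f : B → C} {g : A → B} {h : A → C} →
               (∀ x → f (g x) ≡ h x) → ∀ xs → map f (map g xs) ≡ map h xs
map-map-cong fg≗h xs = trans (sym (map-∘ xs)) (map-cong fg≗h xs)

module PermutationSearch {A : Set} (_≟ᴬ_ : DecidableEquality A) where

  remove : (x : A) (ys : List A) → Maybe (Σ (List A) λ zs → ys ↭ x ∷ zs)
  remove x []       = nothing
  remove x (y ∷ ys) with x ≟ᴬ y
  ... | yes refl = just (ys , ↭-refl)
  ... | no  _    with remove x ys
  ...   | nothing        = nothing
  ...   | just (zs , ys↭) = just (y ∷ zs , ↭-trans (↭-prep y ys↭) (↭-swap y x ↭-refl))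

  _↭?_ : (xs ys : List A) → Maybe (xs ↭ ys)
  []       ↭? []      = just ↭-refl
  []       ↭? (_ ∷ _) = nothing
  (x ∷ xs) ↭? ys      with remove x ys
  ... | nothing         = nothing
  ... | just (zs , ys↭) with xs ↭? zs
  ...   | nothing   = nothing
  ...   | just xs↭ = just (↭-trans (↭-prep x xs↭) (↭-sym ys↭))

  decide↭ : ∀ {xs ys} → Is-just (xs ↭? ys) → xs ↭ ys
  decide↭ = to-witness

-- α-labellings and their extensions

edgeLength : ℕ × ℕ → ℕ
edgeLength (x , y) = ∣ x - y ∣

edgeLength-swap : ∀ e → edgeLength (swap e) ≡ edgeLength e
edgeLength-swap (x , y) = ∣-∣-comm y x

edgeLength-shift : ∀ p e → edgeLength (onBoth (p +_) e) ≡ edgeLength e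
edgeLength-shift p (x , y) = ∣m+n-m+o∣≡∣n-o∣ p x y

Straddles : ℕ → ℕ × ℕ → Set
Straddles a (x , y) = (x ≤ a × a < y) ⊎ (y ≤ a × a < x)

straddles-swap : ∀ {a} e → Straddles a e → Straddles a (swap e)
straddles-swap (x , y) (inj₁ x≤a<y) = inj₂ x≤a<y
straddles-swap (x , y) (inj₂ y≤a<x) = inj₁ y≤a<x

straddles-shift : ∀ {a} p e → Straddles a e → Straddles (a + p) (onBoth (p +_) e)
straddles-shift {a} p (x , y) (inj₁ (x≤a , a<y)) = inj₁ (shift≤ x≤a , shift< a<y)
  where
  shift≤ : x ≤ a → p + x ≤ a + p
  shift≤ x≤a = subst (p + x ≤_) (+-comm p a) (+-monoʳ-≤ p x≤a)
  shift< : a < y → a + p < p + y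
  shift< a<y = subst (_< p + y) (+-comm p a) (+-monoʳ-< p a<y)
straddles-shift {a} p (x , y) (inj₂ y≤a<x) = straddles-swap (p + y , p + x) (straddles-shift p (y , x) (inj₁ y≤a<x))

edgesOf : List (List ℕ) → List ℕ → List (ℕ × ℕ)
edgesOf cycles path = concatMap edgesAround cycles ++ edgesAlong path

-- α-labellings with ε edges and critical value a; the edge lengths stand for ΔΓ (see Δ↭).
record Alpha (ε a : ℕ) (L : List ℕ) : Set where
  field
    cycleLabels  : List (List ℕ)
    pathLabels   : List ℕ
    cycleLengths : map length cycleLabels ≡ L
    labels↭      : concat cycleLabels ++ pathLabels ↭ range 0 (suc ε)
    edgeLengths↭ : map edgeLength (edgesOf cycleLabels pathLabels) ↭ range 1 ε
    straddles    : All (Straddles a) (edgesOf cycleLabels pathLabels)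
    1≤a          : 1 ≤ a
    a<ε          : a < ε

open Alpha

StartsAtOne : ∀ {ε a L} → Alpha ε a L → Set
StartsAtOne S = ∃ λ r → pathLabels S ≡ 1 ∷ r

PathCovers : ∀ {ε a L} → ℕ → Alpha ε a L → Set
PathCovers {ε} c S = ∀ d → c < d → d ≤ ε → d ∈ map edgeLength (edgesAlong (pathLabels S))

data Vertex : Set where
  lo hi : ℕ → Vertex

_≟ᵛ_ : DecidableEquality Vertex
lo i ≟ᵛ lo j with i ≟ j
... | yes refl = yes refl
... | no  i≢j  = no λ { refl → i≢j refl }
lo i ≟ᵛ hi j = no λ ()
hi i ≟ᵛ lo j = no λ ()
hi i ≟ᵛ hi j with i ≟ j
... | yes refl = yes refl
... | no  i≢j  = no λ { refl → i≢j refl }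

index : Vertex → ℕ
index (lo i) = i
index (hi j) = j

label : ℕ → Vertex → ℕ
label e (lo i) = i
label e (hi j) = e ∸ j

indexSum : Vertex × Vertex → ℕ
indexSum (u , v) = index u + index v

Mixed : Vertex × Vertex → Set
Mixed (lo _ , lo _) = ⊥
Mixed (lo _ , hi _) = ⊤
Mixed (hi _ , lo _) = ⊤
Mixed (hi _ , hi _) = ⊥

mixed-swap : ∀ t → Mixed t → Mixed (swap t)
mixed-swap (lo _ , hi _) _ = tt
mixed-swap (hi _ , lo _) _ = tt

indexSum-swap : ∀ t → indexSum (swap t) ≡ indexSum t
indexSum-swap (u , v) = +-comm (index v) (index u)

freshVertices : ℕ → ℕ → List Vertex
freshVertices p q = map lo (range 0 p) ++ map hi (range 0 q)

extensionEdges : List (List Vertex) → List Vertex → ℕ → List (Vertex × Vertex)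
extensionEdges cycles path p = concatMap edgesAround cycles ++ edgesAlong (lo (p + 1) ∷ path)

-- Shifting an α-labelling with ε edges up by p and labelling lo i by i and hi j by
-- e ∸ j, e = ε + (p + q), gives a mixed edge of index sum s the length e ∸ s.  So an
-- extension whose index sums are 0, …, p + q − 1 supplies exactly the missing lengths
-- ε + 1, …, e; its path is attached through lo (p + 1), the image of the old label 1.
record Extension (p q : ℕ) (ℓs : List ℕ) : Set where
  field
    newCycles       : List (List Vertex)
    newPath         : List Vertex
    newCycleLengths : map length newCycles ≡ ℓs
    vertices↭       : concat newCycles ++ newPath ↭ freshVertices p q
    indexSums↭      : map indexSum (extensionEdges newCycles newPath p) ↭ range 0 (p + q)
    mixed           : All Mixed (extensionEdges newCycles newPath p)

open Extension

extEdges : ∀ {p q ℓs} → Extension p q ℓs → List (Vertex × Vertex)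
extEdges {p} X = extensionEdges (newCycles X) (newPath X) p

EndsAtOne : ∀ {p q ℓs} → Extension p q ℓs → Set
EndsAtOne X = ∃ λ o → newPath X ≡ o ++ [ lo 1 ]

edgeLength-label : ∀ e t → Mixed t → indexSum t ≤ e → edgeLength (onBoth (label e) t) ≡ e ∸ indexSum t
edgeLength-label e (lo i , hi j) _ i+j≤e = begin
  ∣ i - e ∸ j ∣ ≡⟨ m≤n⇒∣m-n∣≡n∸m (i≤e∸j i j i+j≤e) ⟩
  e ∸ j ∸ i     ≡⟨ ∸-+-assoc e j i ⟩
  e ∸ (j + i)   ≡⟨ cong (e ∸_) (+-comm j i) ⟩
  e ∸ (i + j)   ∎
  where
  open ≡-Reasoning
  i≤e∸j : ∀ i j → i + j ≤ e → i ≤ e ∸ j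
  i≤e∸j i j le = subst (_≤ e ∸ j) (m+n∸n≡m i j) (∸-monoˡ-≤ j le)
edgeLength-label e (hi j , lo i) _ j+i≤e = begin
  ∣ e ∸ j - i ∣ ≡⟨ ∣-∣-comm (e ∸ j) i ⟩
  ∣ i - e ∸ j ∣ ≡⟨ edgeLength-label e (lo i , hi j) tt (subst (_≤ e) (+-comm j i) j+i≤e) ⟩
  e ∸ (i + j)   ≡⟨ cong (e ∸_) (+-comm i j) ⟩
  e ∸ (j + i)   ∎
  where open ≡-Reasoning

Bounded : ℕ → ℕ → Vertex → Set
Bounded p q (lo i) = i ≤ p + 1
Bounded p q (hi j) = j < q

freshVertices-bounded : ∀ p q → All (Bounded p q) (freshVertices p q)
freshVertices-bounded p q = All.++⁺
  (All.map⁺ (All.tabulate λ i∈ → ≤-trans (<⇒≤ (proj₂ (∈-range⁻ 0 p i∈))) (m≤m+n p 1)))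
  (All.map⁺ (All.tabulate λ j∈ → proj₂ (∈-range⁻ 0 q j∈)))

straddles-label : ∀ {ε a p q} → 1 ≤ a → a < ε → ∀ t → Mixed t → Bounded p q (proj₁ t) × Bounded p q (proj₂ t) →
                  Straddles (a + p) (onBoth (label (ε + (p + q))) t)
straddles-label {ε} {a} {p} {q} 1≤a a<ε (lo i , hi j) _ (i≤ , j<) = inj₁ (low i≤ , high j<)
  where
  low : i ≤ p + 1 → i ≤ a + p
  low i≤ = ≤-trans i≤ (subst (_≤ a + p) (+-comm 1 p) (+-monoˡ-≤ p 1≤a))
  high : j < q → a + p < ε + (p + q) ∸ j
  high j< = subst (_≤ ε + (p + q) ∸ j) (m+n∸n≡m (suc (a + p)) j)
    (∸-monoˡ-≤ j (≤-trans (+-mono-≤ (+-monoˡ-≤ p a<ε) (<⇒≤ j<)) (≤-reflexive (+-assoc ε p q))))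
straddles-label 1≤a a<ε (hi j , lo i) _ (j< , i≤) =
  straddles-swap (_ , _) (straddles-label 1≤a a<ε (lo i , hi j) tt (i≤ , j<))

module _ {p q ℓs} (X : Extension p q ℓs) where

  indexSum-bound : All (λ t → indexSum t < p + q) (extEdges X)
  indexSum-bound = All.map⁻ (All-resp-↭ (↭-sym (indexSums↭ X))
    (All.tabulate (λ s∈ → proj₂ (∈-range⁻ 0 (p + q) s∈))))

  endpoints-bounded : All (λ t → Bounded p q (proj₁ t) × Bounded p q (proj₂ t)) (extEdges X)
  endpoints-bounded = All.tabulate λ t∈ → Product.map bounded bounded (endpoints t∈)
    where
    attached : List Vertex
    attached = lo (p + 1) ∷ concat (newCycles X) ++ newPath X
    bounded : ∀ {v} → v ∈ attached → Bounded p q v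
    bounded = All.lookup (≤-refl ∷ All-resp-↭ (↭-sym (vertices↭ X)) (freshVertices-bounded p q))
    endpoints : ∀ {t} → t ∈ extEdges X → proj₁ t ∈ attached × proj₂ t ∈ attached
    endpoints t∈ with ∈-++⁻ (concatMap edgesAround (newCycles X)) t∈
    ... | inj₁ t∈′ = Product.map (there ∘ ∈-++⁺ˡ) (there ∘ ∈-++⁺ˡ) (∈-concatMap-edgesAround⁻ (newCycles X) t∈′)
    ... | inj₂ t∈′ = Product.map inPath inPath (∈-edgesAlong⁻ (lo (p + 1) ∷ newPath X) t∈′)
      where
      inPath : ∀ {v} → v ∈ lo (p + 1) ∷ newPath X → v ∈ attached
      inPath (here refl) = here refl
      inPath (there v∈)  = there (∈-++⁺ʳ (concat (newCycles X)) v∈)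

map-edgeLength-label : ∀ e ts → All (λ t → Mixed t × indexSum t ≤ e) ts →
                       map edgeLength (map (onBoth (label e)) ts) ≡ map (e ∸_) (map indexSum ts)
map-edgeLength-label e ts ok = trans (sym (map-∘ ts))
  (trans (map-cong-local (All.map (λ { {t} (m , ≤e) → edgeLength-label e t m ≤e }) ok)) (map-∘ ts))

map-label-freshVertices : ∀ ε p q → map (label (ε + (p + q))) (freshVertices p q) ↭ range 0 p ++ range (suc (p + ε)) q
map-label-freshVertices ε p q = begin
  map (label e) (map lo (range 0 p) ++ map hi (range 0 q))
    ≡⟨ map-++ (label e) (map lo (range 0 p)) _ ⟩
  map (label e) (map lo (range 0 p)) ++ map (label e) (map hi (range 0 q))
    ≡⟨ cong₂ _++_ (trans (map-map-cong (λ _ → refl) (range 0 p)) (map-id (range 0 p))) (map-map-cong (λ _ → refl) (range 0 q)) ⟩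
  range 0 p ++ map (e ∸_) (range 0 q)
    ↭⟨ ++⁺ˡ (range 0 p) (map-∸-range e 0 q (p + ε) p+ε+q+0≡e) ⟩
  range 0 p ++ range (suc (p + ε)) q ∎
  where
  open PermutationReasoning
  e : ℕ
  e = ε + (p + q)
  p+ε+q+0≡e : p + ε + q + 0 ≡ e
  p+ε+q+0≡e = trans (+-identityʳ _) (trans (cong (_+ q) (+-comm p ε)) (+-assoc ε p q))

range-interleave : ∀ ε p q → (range 0 p ++ range (suc (p + ε)) q) ++ range p (suc ε) ↭ range 0 (suc (ε + (p + q)))
range-interleave ε p q = begin
  (range 0 p ++ range (suc (p + ε)) q) ++ range p (suc ε) ≡⟨ ++-assoc (range 0 p) _ _ ⟩
  range 0 p ++ range (suc (p + ε)) q ++ range p (suc ε)   ↭⟨ ++⁺ˡ (range 0 p) (↭-++-comm (range (suc (p + ε)) q) _) ⟩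
  range 0 p ++ range p (suc ε) ++ range (suc (p + ε)) q   ≡⟨ cong (λ b → range 0 p ++ range p (suc ε) ++ range b q) (sym (+-suc p ε)) ⟩
  range 0 p ++ range p (suc ε) ++ range (p + suc ε) q     ≡⟨ ++-assoc (range 0 p) _ _ ⟨
  (range 0 p ++ range p (suc ε)) ++ range (p + suc ε) q   ≡⟨ cong (_++ range (p + suc ε) q) (range-++ 0 p (suc ε)) ⟨
  range 0 (p + suc ε) ++ range (p + suc ε) q               ≡⟨ range-++ 0 (p + suc ε) q ⟨
  range 0 (p + suc ε + q)                                 ≡⟨ cong (range 0) (p+1+ε+q≡ ε p q) ⟩
  range 0 (suc (ε + (p + q)))                             ∎
  where
  open PermutationReasoning
  p+1+ε+q≡ : ∀ ε p q → p + suc ε + q ≡ suc (ε + (p + q))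
  p+1+ε+q≡ = solve-∀

module Extend {ε a L p q ℓs} (S : Alpha ε a L) (atOne : StartsAtOne S) (X : Extension p q ℓs) where

  r : List ℕ
  r = proj₁ atOne

  starts : pathLabels S ≡ 1 ∷ r
  starts = proj₂ atOne

  e : ℕ
  e = ε + (p + q)

  cycles′ : List (List ℕ)
  cycles′ = map (map (label e)) (newCycles X) ++ map (map (p +_)) (cycleLabels S)

  path′ : List ℕ
  path′ = map (label e) (reverse (newPath X)) ++ map (p +_) (pathLabels S)

  newCycleEdges newPathEdges : List (Vertex × Vertex)
  newCycleEdges = concatMap edgesAround (newCycles X)
  newPathEdges  = edgesAlong (lo (p + 1) ∷ newPath X)

  pathEdges↭ : edgesAlong path′ ↭
               map swap (map (onBoth (label e)) newPathEdges) ++ map (onBoth (p +_)) (edgesAlong (pathLabels S))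
  pathEdges↭ = begin
    edgesAlong path′
      ≡⟨ cong₂ (λ u v → edgesAlong (u ++ map (p +_) v)) (reverse-map (label e) (newPath X)) starts ⟩
    edgesAlong (reverse (map (label e) (newPath X)) ++ p + 1 ∷ map (p +_) r)
      ↭⟨ edgesAlong-glue (map (label e) (newPath X)) (p + 1) (map (p +_) r) ⟩
    map swap (edgesAlong (map (label e) (lo (p + 1) ∷ newPath X))) ++ edgesAlong (map (p +_) (1 ∷ r))
      ≡⟨ cong₂ (λ u v → map swap u ++ v) (edgesAlong-map (label e) (lo (p + 1) ∷ newPath X))
                                          (trans (cong (λ z → map (onBoth (p +_)) (edgesAlong z)) starts) (edgesAlong-map (p +_) (1 ∷ r))) ⟨
    map swap (map (onBoth (label e)) newPathEdges) ++ map (onBoth (p +_)) (edgesAlong (pathLabels S)) ∎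
    where open PermutationReasoning

  newEdges oldEdges : List (ℕ × ℕ)
  newEdges = map (onBoth (label e)) newCycleEdges ++ map swap (map (onBoth (label e)) newPathEdges)
  oldEdges = map (onBoth (p +_)) (edgesOf (cycleLabels S) (pathLabels S))

  edges↭ : edgesOf cycles′ path′ ↭ newEdges ++ oldEdges
  edges↭ = begin
    concatMap edgesAround cycles′ ++ edgesAlong path′
      ≡⟨ cong (_++ edgesAlong path′) (concatMap-++ edgesAround (map (map (label e)) (newCycles X)) _) ⟩
    (concatMap edgesAround (map (map (label e)) (newCycles X)) ++ concatMap edgesAround (map (map (p +_)) (cycleLabels S))) ++ edgesAlong path′
      ≡⟨ cong₂ (λ u v → (u ++ v) ++ edgesAlong path′) (concatMap-edgesAround-map (label e) (newCycles X))
                                                         (concatMap-edgesAround-map (p +_) (cycleLabels S)) ⟩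
    (onNewCycles ++ onOldCycles) ++ edgesAlong path′ ↭⟨ ++⁺ˡ _ pathEdges↭ ⟩
    (onNewCycles ++ onOldCycles) ++ (onNewPath ++ onOldPath) ↭⟨ ↭-interchange onNewCycles onOldCycles onNewPath onOldPath ⟩
    newEdges ++ (onOldCycles ++ onOldPath)        ≡⟨ cong (newEdges ++_) (map-++ (onBoth (p +_)) (concatMap edgesAround (cycleLabels S)) _) ⟨
    newEdges ++ oldEdges ∎
    where
    open PermutationReasoning
    onNewCycles onOldCycles onNewPath onOldPath : List (ℕ × ℕ)
    onNewCycles = map (onBoth (label e)) newCycleEdges
    onOldCycles = map (onBoth (p +_)) (concatMap edgesAround (cycleLabels S))
    onNewPath   = map swap (map (onBoth (label e)) newPathEdges)
    onOldPath   = map (onBoth (p +_)) (edgesAlong (pathLabels S))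

  fits : All (λ t → Mixed t × indexSum t ≤ e) (extEdges X)
  fits = All.zipWith (λ (m , s<) → m , ≤-trans (<⇒≤ s<) (m≤n+m (p + q) ε)) (mixed X , indexSum-bound X)

  newPathEdgeLengths : map edgeLength (map swap (map (onBoth (label e)) newPathEdges)) ≡ map (e ∸_) (map indexSum newPathEdges)
  newPathEdgeLengths = trans (map-map-cong edgeLength-swap _) (map-edgeLength-label e newPathEdges (All.++⁻ʳ newCycleEdges fits))

  newEdgeLengths : map edgeLength newEdges ≡ map (e ∸_) (map indexSum (extEdges X))
  newEdgeLengths = begin
    map edgeLength newEdges
      ≡⟨ map-++ edgeLength (map (onBoth (label e)) newCycleEdges) _ ⟩
    map edgeLength (map (onBoth (label e)) newCycleEdges) ++ map edgeLength (map swap (map (onBoth (label e)) newPathEdges))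
      ≡⟨ cong₂ _++_ (map-edgeLength-label e newCycleEdges (All.++⁻ˡ newCycleEdges fits)) newPathEdgeLengths ⟩
    map (e ∸_) (map indexSum newCycleEdges) ++ map (e ∸_) (map indexSum newPathEdges)
      ≡⟨ trans (sym (map-++ (e ∸_) (map indexSum newCycleEdges) _)) (cong (map (e ∸_)) (sym (map-++ indexSum newCycleEdges _))) ⟩
    map (e ∸_) (map indexSum (extEdges X)) ∎
    where open ≡-Reasoning

  newLengths↭ : ∀ {ts} → map indexSum ts ↭ range 0 (p + q) → map (e ∸_) (map indexSum ts) ↭ range (suc ε) (p + q)
  newLengths↭ sums↭ = ↭-trans (map⁺ (e ∸_) sums↭) (map-∸-range e 0 (p + q) ε (+-identityʳ e))

  edgeLengths↭′ : map edgeLength (edgesOf cycles′ path′) ↭ range 1 e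
  edgeLengths↭′ = begin
    map edgeLength (edgesOf cycles′ path′)                   ↭⟨ map⁺ edgeLength edges↭ ⟩
    map edgeLength (newEdges ++ oldEdges)                    ≡⟨ map-++ edgeLength newEdges oldEdges ⟩
    map edgeLength newEdges ++ map edgeLength oldEdges       ≡⟨ cong₂ _++_ newEdgeLengths (map-map-cong (edgeLength-shift p) _) ⟩
    map (e ∸_) (map indexSum (extEdges X)) ++ map edgeLength (edgesOf (cycleLabels S) (pathLabels S))
                                                             ↭⟨ ++⁺ (newLengths↭ (indexSums↭ X)) (edgeLengths↭ S) ⟩
    range (suc ε) (p + q) ++ range 1 ε                       ↭⟨ ↭-++-comm (range (suc ε) (p + q)) (range 1 ε) ⟩
    range 1 ε ++ range (suc ε) (p + q)                       ≡⟨ range-++ 1 ε (p + q) ⟨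
    range 1 e                                                ∎
    where open PermutationReasoning

  labels↭′ : concat cycles′ ++ path′ ↭ range 0 (suc e)
  labels↭′ = begin
    concat cycles′ ++ path′
      ≡⟨ cong (_++ path′) (trans (sym (concat-++ (map (map (label e)) (newCycles X)) _))
                                 (cong₂ _++_ (concat-map (newCycles X)) (concat-map (cycleLabels S)))) ⟩
    (onNewCycles ++ onOldCycles) ++ (onNewPath ++ onOldPath)
      ↭⟨ ↭-interchange onNewCycles onOldCycles onNewPath onOldPath ⟩
    (onNewCycles ++ onNewPath) ++ (onOldCycles ++ onOldPath)
      ↭⟨ ++⁺ (++⁺ˡ onNewCycles (map⁺ (label e) (↭-reverse (newPath X)))) (↭-reflexive (sym (map-++ (p +_) (concat (cycleLabels S)) _))) ⟩
    (onNewCycles ++ map (label e) (newPath X)) ++ map (p +_) (concat (cycleLabels S) ++ pathLabels S)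
      ≡⟨ cong (_++ _) (map-++ (label e) (concat (newCycles X)) (newPath X)) ⟨
    map (label e) (concat (newCycles X) ++ newPath X) ++ map (p +_) (concat (cycleLabels S) ++ pathLabels S)
      ↭⟨ ++⁺ (map⁺ (label e) (vertices↭ X)) (map⁺ (p +_) (labels↭ S)) ⟩
    map (label e) (freshVertices p q) ++ map (p +_) (range 0 (suc ε))
      ↭⟨ ++⁺ (map-label-freshVertices ε p q) (↭-reflexive (trans (map-+-range p 0 (suc ε)) (cong (λ b → range b (suc ε)) (+-identityʳ p)))) ⟩
    (range 0 p ++ range (suc (p + ε)) q) ++ range p (suc ε)
      ↭⟨ range-interleave ε p q ⟩
    range 0 (suc e) ∎
    where
    open PermutationReasoning
    onNewCycles onOldCycles onNewPath onOldPath : List ℕ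
    onNewCycles = map (label e) (concat (newCycles X))
    onOldCycles = map (p +_) (concat (cycleLabels S))
    onNewPath   = map (label e) (reverse (newPath X))
    onOldPath   = map (p +_) (pathLabels S)

  straddles′ : All (Straddles (a + p)) (edgesOf cycles′ path′)
  straddles′ = All-resp-↭ (↭-sym edges↭) (All.++⁺ (All.++⁺ newOnCycles (All.map⁺ (All.map (λ {t} → straddles-swap t) newOnPath))) old)
    where
    new : All (Straddles (a + p)) (map (onBoth (label e)) (extEdges X))
    new = All.map⁺ (All.zipWith (λ {t} (m , b) → straddles-label (1≤a S) (a<ε S) t m b) (mixed X , endpoints-bounded X))
    new′ : All (Straddles (a + p)) (map (onBoth (label e)) newCycleEdges ++ map (onBoth (label e)) newPathEdges)
    new′ = subst (All (Straddles (a + p))) (map-++ (onBoth (label e)) newCycleEdges newPathEdges) new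
    newOnCycles : All (Straddles (a + p)) (map (onBoth (label e)) newCycleEdges)
    newOnCycles = All.++⁻ˡ _ new′
    newOnPath : All (Straddles (a + p)) (map (onBoth (label e)) newPathEdges)
    newOnPath = All.++⁻ʳ (map (onBoth (label e)) newCycleEdges) new′
    old : All (Straddles (a + p)) oldEdges
    old = All.map⁺ (All.map (λ {t} → straddles-shift p t) (straddles S))

  result : Alpha e (a + p) (ℓs ++ L)
  result = record
    { cycleLabels  = cycles′
    ; pathLabels   = path′
    ; cycleLengths = trans (map-++ length (map (map (label e)) (newCycles X)) _)
                           (cong₂ _++_ (trans (map-map-cong (length-map (label e)) (newCycles X)) (newCycleLengths X))
                                       (trans (map-map-cong (length-map (p +_)) (cycleLabels S)) (cycleLengths S)))
    ; labels↭      = labels↭′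
    ; edgeLengths↭ = edgeLengths↭′
    ; straddles    = straddles′
    ; 1≤a          = ≤-trans (1≤a S) (m≤m+n a p)
    ; a<ε          = +-mono-<-≤ (a<ε S) (m≤m+n p q)
    }

  startsAtOne : ∀ o → newPath X ≡ o ++ [ lo 1 ] → StartsAtOne result
  startsAtOne o ends =
    _ , cong (λ z → map (label e) z ++ map (p +_) (pathLabels S)) (trans (cong reverse ends) (reverse-++ o [ lo 1 ]))

  pathCovers : newCycles X ≡ [] → ∀ c → PathCovers c S → PathCovers c result
  pathCovers noCycles c covers d c<d d≤e = ∈-resp-↭ (↭-sym pathLengths↭) d∈
    where
    pathSums↭ : map indexSum newPathEdges ↭ range 0 (p + q)
    pathSums↭ = subst (λ cs → map indexSum (concatMap edgesAround cs ++ newPathEdges) ↭ range 0 (p + q)) noCycles (indexSums↭ X)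
    pathLengths↭ : map edgeLength (edgesAlong path′) ↭ range (suc ε) (p + q) ++ map edgeLength (edgesAlong (pathLabels S))
    pathLengths↭ = begin
      map edgeLength (edgesAlong path′)
        ↭⟨ map⁺ edgeLength pathEdges↭ ⟩
      map edgeLength (map swap (map (onBoth (label e)) newPathEdges) ++ map (onBoth (p +_)) (edgesAlong (pathLabels S)))
        ≡⟨ map-++ edgeLength (map swap (map (onBoth (label e)) newPathEdges)) _ ⟩
      map edgeLength (map swap (map (onBoth (label e)) newPathEdges)) ++ map edgeLength (map (onBoth (p +_)) (edgesAlong (pathLabels S)))
        ≡⟨ cong₂ _++_ newPathEdgeLengths (map-map-cong (edgeLength-shift p) _) ⟩
      map (e ∸_) (map indexSum newPathEdges) ++ map edgeLength (edgesAlong (pathLabels S))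
        ↭⟨ ++⁺ʳ _ (newLengths↭ pathSums↭) ⟩
      range (suc ε) (p + q) ++ map edgeLength (edgesAlong (pathLabels S)) ∎
      where open PermutationReasoning
    d∈ : d ∈ range (suc ε) (p + q) ++ map edgeLength (edgesAlong (pathLabels S))
    d∈ with d ≤? ε
    ... | yes d≤ε = ∈-++⁺ʳ (range (suc ε) (p + q)) (covers d c<d d≤ε)
    ... | no  d≰ε = ∈-++⁺ˡ (∈-range⁺ (suc ε) (p + q) (≰⇒> d≰ε) (s≤s d≤e))

open PermutationSearch _≟_  using () renaming (_↭?_ to _↭ᴺ?_; decide↭ to decideᴺ↭)
open PermutationSearch _≟ᵛ_ using () renaming (_↭?_ to _↭ⱽ?_; decide↭ to decideⱽ↭)

initialPath : Alpha 3 1 []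
initialPath = record
  { cycleLabels  = []
  ; pathLabels   = 1 ∷ 2 ∷ 0 ∷ 3 ∷ []
  ; cycleLengths = refl
  ; labels↭      = decideᴺ↭ (Maybe.just tt)
  ; edgeLengths↭ = decideᴺ↭ (Maybe.just tt)
  ; straddles    = inj₁ (≤-refl , s≤s (s≤s z≤n)) ∷ inj₂ (z≤n , s≤s (s≤s z≤n)) ∷ inj₁ (z≤n , s≤s (s≤s z≤n)) ∷ []
  ; 1≤a          = ≤-refl
  ; a<ε          = s≤s (s≤s z≤n)
  }

pathOnlyExtension : ∀ p q (path : List Vertex) →
                    Is-just (path ↭ⱽ? freshVertices p q) →
                    Is-just (map indexSum (edgesAlong (lo (p + 1) ∷ path)) ↭ᴺ? range 0 (p + q)) →
                    All Mixed (edgesAlong (lo (p + 1) ∷ path)) → Extension p q []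
pathOnlyExtension p q path vertices sums mixed = record
  { newCycles = [] ; newPath = path ; newCycleLengths = refl
  ; vertices↭ = decideⱽ↭ vertices ; indexSums↭ = decideᴺ↭ sums ; mixed = mixed }

pathExtension₃ : Extension 1 2 []
pathExtension₃ = pathOnlyExtension 1 2 (hi 0 ∷ lo 0 ∷ hi 1 ∷ []) (Maybe.just tt) (Maybe.just tt) (tt ∷ tt ∷ tt ∷ [])

pathExtension₄ : Extension 2 2 []
pathExtension₄ = pathOnlyExtension 2 2 (hi 0 ∷ lo 0 ∷ hi 1 ∷ lo 1 ∷ []) (Maybe.just tt) (Maybe.just tt) (tt ∷ tt ∷ tt ∷ tt ∷ [])

pathExtension₆ : Extension 3 3 []
pathExtension₆ = pathOnlyExtension 3 3 (hi 1 ∷ lo 0 ∷ hi 0 ∷ lo 2 ∷ hi 2 ∷ lo 1 ∷ []) (Maybe.just tt) (Maybe.just tt) (tt ∷ tt ∷ tt ∷ tt ∷ tt ∷ tt ∷ [])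

-- Ladders and the cycle extensions

rungsX rungsY rungsP : List Vertex → ℕ → List Vertex
rungsX z zero    = z
rungsX z (suc s) = lo (3 * s + 5) ∷ hi (3 * s + 3) ∷ rungsX z s
rungsY z zero    = z
rungsY z (suc s) = hi (3 * s + 4) ∷ lo (3 * s + 3) ∷ rungsY z s
rungsP z zero    = z
rungsP z (suc s) = lo (3 * s + 4) ∷ hi (3 * s + 2) ∷ rungsP z s

-- ladderX z s is hi (3s + 3), lo (3s + 2), hi 3s, …, lo 5, hi 3 followed by z; the other two
-- ladders descend in the same way, and at level k ≥ 1 the three of them have the consecutive
-- index sums 6k, …, 6k + 5 (level-sums).
ladderX ladderY ladderP : List Vertex → ℕ → List Vertex
ladderX z s = hi (3 * s + 3) ∷ rungsX z s
ladderY z s = lo (3 * s + 3) ∷ rungsY z s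
ladderP z s = hi (3 * s + 2) ∷ rungsP z s

rungsX-++ : ∀ z w s → rungsX z s ++ w ≡ rungsX (z ++ w) s
rungsX-++ z w zero    = refl
rungsX-++ z w (suc s) = cong (λ u → lo (3 * s + 5) ∷ hi (3 * s + 3) ∷ u) (rungsX-++ z w s)

rungsY-++ : ∀ z w s → rungsY z s ++ w ≡ rungsY (z ++ w) s
rungsY-++ z w zero    = refl
rungsY-++ z w (suc s) = cong (λ u → hi (3 * s + 4) ∷ lo (3 * s + 3) ∷ u) (rungsY-++ z w s)

rungsP-++ : ∀ z w s → rungsP z s ++ w ≡ rungsP (z ++ w) s
rungsP-++ z w zero    = refl
rungsP-++ z w (suc s) = cong (λ u → lo (3 * s + 4) ∷ hi (3 * s + 2) ∷ u) (rungsP-++ z w s)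

ladderP-ends : ∀ z s → ladderP (z ++ [ lo 1 ]) s ≡ ladderP z s ++ [ lo 1 ]
ladderP-ends z s = cong (hi (3 * s + 2) ∷_) (sym (rungsP-++ z [ lo 1 ] s))

2+2s+n≡2[1+s]+n : ∀ s n → suc (suc (2 * s + n)) ≡ 2 * suc s + n
2+2s+n≡2[1+s]+n = solve-∀

length-rungsX : ∀ z s → length (rungsX z s) ≡ 2 * s + length z
length-rungsX z zero    = refl
length-rungsX z (suc s) = trans (cong (λ n → suc (suc n)) (length-rungsX z s)) (2+2s+n≡2[1+s]+n s (length z))

length-rungsY : ∀ z s → length (rungsY z s) ≡ 2 * s + length z
length-rungsY z zero    = refl
length-rungsY z (suc s) = trans (cong (λ n → suc (suc n)) (length-rungsY z s)) (2+2s+n≡2[1+s]+n s (length z))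

mixed-ladderX : ∀ z s → All Mixed (edgesAlong (ladderX z 0)) → All Mixed (edgesAlong (ladderX z s))
mixed-ladderX z zero    m = m
mixed-ladderX z (suc s) m = tt ∷ tt ∷ mixed-ladderX z s m

mixed-ladderY : ∀ z s → All Mixed (edgesAlong (ladderY z 0)) → All Mixed (edgesAlong (ladderY z s))
mixed-ladderY z zero    m = m
mixed-ladderY z (suc s) m = tt ∷ tt ∷ mixed-ladderY z s m

mixed-ladderP : ∀ z s → All Mixed (edgesAlong (ladderP z 0)) → All Mixed (edgesAlong (ladderP z s))
mixed-ladderP z zero    m = m
mixed-ladderP z (suc s) m = tt ∷ tt ∷ mixed-ladderP z s m

↭-gather : ∀ {A : Set} (a b c d e f : A) xs ys zs →
           (a ∷ b ∷ xs) ++ (c ∷ d ∷ ys) ++ (e ∷ f ∷ zs) ↭ (xs ++ ys ++ zs) ++ (a ∷ b ∷ c ∷ d ∷ e ∷ f ∷ [])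
↭-gather a b c d e f xs ys zs =
  ↭-trans (++⁺ˡ (a ∷ b ∷ []) (++⁺ˡ xs (++⁺ˡ (c ∷ d ∷ []) (shifts ys (e ∷ f ∷ []) {zs}))))
  (↭-trans (++⁺ˡ (a ∷ b ∷ []) (shifts xs (c ∷ d ∷ e ∷ f ∷ []) {ys ++ zs}))
           (↭-++-comm (a ∷ b ∷ c ∷ d ∷ e ∷ f ∷ []) (xs ++ ys ++ zs)))

loHi : ℕ → ℕ → List Vertex
loHi a n = map lo (range a n) ++ map hi (range a n)

loHi-++ : ∀ a m n → loHi a (m + n) ↭ loHi a m ++ loHi (a + m) n
loHi-++ a m n = ↭-trans
  (↭-reflexive (cong₂ _++_ (trans (cong (map lo) (range-++ a m n)) (map-++ lo (range a m) _))
                           (trans (cong (map hi) (range-++ a m n)) (map-++ hi (range a m) _))))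
  (↭-interchange (map lo (range a m)) (map lo (range (a + m) n)) (map hi (range a m)) (map hi (range (a + m) n)))

shiftVertex : ℕ → Vertex → Vertex
shiftVertex y (lo i) = lo (i + y)
shiftVertex y (hi j) = hi (j + y)

level-vertices : ∀ s → hi (3 * suc s + 3) ∷ lo (3 * s + 5) ∷ lo (3 * suc s + 3) ∷ hi (3 * s + 4) ∷ hi (3 * suc s + 2) ∷ lo (3 * s + 4) ∷ []
                       ↭ loHi (4 + 3 * s) 3
level-vertices s = ↭-trans (↭-reflexive shifted)
  (map⁺ (shiftVertex (4 + 3 * s)) (decideⱽ↭ {hi 2 ∷ lo 1 ∷ lo 2 ∷ hi 0 ∷ hi 1 ∷ lo 0 ∷ []} {loHi 0 3} (Maybe.just tt)))
  where
  e₂ : ∀ s → 3 * suc s + 3 ≡ 2 + (4 + 3 * s)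
  e₂ = solve-∀
  e₁ : ∀ s → 3 * s + 5 ≡ 1 + (4 + 3 * s)
  e₁ = solve-∀
  e₀ : ∀ s → 3 * s + 4 ≡ 0 + (4 + 3 * s)
  e₀ = solve-∀
  e₁′ : ∀ s → 3 * suc s + 2 ≡ 1 + (4 + 3 * s)
  e₁′ = solve-∀
  shifted : hi (3 * suc s + 3) ∷ lo (3 * s + 5) ∷ lo (3 * suc s + 3) ∷ hi (3 * s + 4) ∷ hi (3 * suc s + 2) ∷ lo (3 * s + 4) ∷ []
            ≡ map (shiftVertex (4 + 3 * s)) (hi 2 ∷ lo 1 ∷ lo 2 ∷ hi 0 ∷ hi 1 ∷ lo 0 ∷ [])
  shifted = cong₂ _∷_ (cong hi (e₂ s)) (cong₂ _∷_ (cong lo (e₁ s)) (cong₂ _∷_ (cong lo (e₂ s))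
            (cong₂ _∷_ (cong hi (e₀ s)) (cong₂ _∷_ (cong hi (e₁′ s)) (cong₂ _∷_ (cong lo (e₀ s)) refl)))))

ladder-vertices : ∀ zx zy zp s → ladderX zx s ++ ladderY zy s ++ ladderP zp s ↭
                                 (ladderX zx 0 ++ ladderY zy 0 ++ ladderP zp 0) ++ loHi 4 (3 * s)
ladder-vertices zx zy zp zero    = ↭-reflexive (sym (++-identityʳ _))
ladder-vertices zx zy zp (suc s) = begin
  ladderX zx (suc s) ++ ladderY zy (suc s) ++ ladderP zp (suc s)
    ↭⟨ ↭-gather _ _ _ _ _ _ (ladderX zx s) (ladderY zy s) (ladderP zp s) ⟩
  (ladderX zx s ++ ladderY zy s ++ ladderP zp s) ++ _
    ↭⟨ ++⁺ (ladder-vertices zx zy zp s) (level-vertices s) ⟩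
  (bottom ++ loHi 4 (3 * s)) ++ loHi (4 + 3 * s) 3 ≡⟨ ++-assoc bottom (loHi 4 (3 * s)) _ ⟩
  bottom ++ loHi 4 (3 * s) ++ loHi (4 + 3 * s) 3   ↭⟨ ++⁺ˡ bottom (↭-sym (loHi-++ 4 (3 * s) 3)) ⟩
  bottom ++ loHi 4 (3 * s + 3)                     ≡⟨ cong (λ n → bottom ++ loHi 4 n) (3s+3≡3[1+s] s) ⟩
  bottom ++ loHi 4 (3 * suc s)                     ∎
  where
  open PermutationReasoning
  bottom : List Vertex
  bottom = ladderX zx 0 ++ ladderY zy 0 ++ ladderP zp 0
  3s+3≡3[1+s] : ∀ s → 3 * s + 3 ≡ 3 * suc s
  3s+3≡3[1+s] = solve-∀

sumsX sumsY sumsP : List Vertex → ℕ → List ℕ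
sumsX z s = map indexSum (edgesAlong (ladderX z s))
sumsY z s = map indexSum (edgesAlong (ladderY z s))
sumsP z s = map indexSum (edgesAlong (ladderP z s))

level-sums : ∀ s → (3 * suc s + 3 + (3 * s + 5)) ∷ (3 * s + 5 + (3 * s + 3)) ∷ (3 * suc s + 3 + (3 * s + 4)) ∷
                   (3 * s + 4 + (3 * s + 3)) ∷ (3 * suc s + 2 + (3 * s + 4)) ∷ (3 * s + 4 + (3 * s + 2)) ∷ []
                   ↭ range (6 + 6 * s) 6
level-sums s = ↭-trans (↭-reflexive shifted)
  (map⁺ (_+ (6 + 6 * s)) (decideᴺ↭ {5 ∷ 2 ∷ 4 ∷ 1 ∷ 3 ∷ 0 ∷ []} {range 0 6} (Maybe.just tt)))
  where
  e₅ : ∀ s → 3 * suc s + 3 + (3 * s + 5) ≡ 5 + (6 + 6 * s)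
  e₅ = solve-∀
  e₂ : ∀ s → 3 * s + 5 + (3 * s + 3) ≡ 2 + (6 + 6 * s)
  e₂ = solve-∀
  e₄ : ∀ s → 3 * suc s + 3 + (3 * s + 4) ≡ 4 + (6 + 6 * s)
  e₄ = solve-∀
  e₁ : ∀ s → 3 * s + 4 + (3 * s + 3) ≡ 1 + (6 + 6 * s)
  e₁ = solve-∀
  e₃ : ∀ s → 3 * suc s + 2 + (3 * s + 4) ≡ 3 + (6 + 6 * s)
  e₃ = solve-∀
  e₀ : ∀ s → 3 * s + 4 + (3 * s + 2) ≡ 0 + (6 + 6 * s)
  e₀ = solve-∀
  shifted : (3 * suc s + 3 + (3 * s + 5)) ∷ (3 * s + 5 + (3 * s + 3)) ∷ (3 * suc s + 3 + (3 * s + 4)) ∷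
            (3 * s + 4 + (3 * s + 3)) ∷ (3 * suc s + 2 + (3 * s + 4)) ∷ (3 * s + 4 + (3 * s + 2)) ∷ []
            ≡ map (_+ (6 + 6 * s)) (5 ∷ 2 ∷ 4 ∷ 1 ∷ 3 ∷ 0 ∷ [])
  shifted = cong₂ _∷_ (e₅ s) (cong₂ _∷_ (e₂ s) (cong₂ _∷_ (e₄ s) (cong₂ _∷_ (e₁ s) (cong₂ _∷_ (e₃ s) (cong₂ _∷_ (e₀ s) refl)))))

ladder-sums : ∀ zx zy zp s → sumsX zx s ++ sumsY zy s ++ sumsP zp s ↭ (sumsX zx 0 ++ sumsY zy 0 ++ sumsP zp 0) ++ range 6 (6 * s)
ladder-sums zx zy zp zero    = ↭-reflexive (sym (++-identityʳ _))
ladder-sums zx zy zp (suc s) = begin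
  sumsX zx (suc s) ++ sumsY zy (suc s) ++ sumsP zp (suc s)
    ↭⟨ ↭-gather _ _ _ _ _ _ (sumsX zx s) (sumsY zy s) (sumsP zp s) ⟩
  (sumsX zx s ++ sumsY zy s ++ sumsP zp s) ++ _
    ↭⟨ ++⁺ (ladder-sums zx zy zp s) (level-sums s) ⟩
  (bottom ++ range 6 (6 * s)) ++ range (6 + 6 * s) 6 ≡⟨ ++-assoc bottom (range 6 (6 * s)) _ ⟩
  bottom ++ range 6 (6 * s) ++ range (6 + 6 * s) 6   ≡⟨ cong (bottom ++_) (range-++ 6 (6 * s) 6) ⟨
  bottom ++ range 6 (6 * s + 6)                      ≡⟨ cong (λ n → bottom ++ range 6 n) (6s+6≡6[1+s] s) ⟩
  bottom ++ range 6 (6 * suc s)                      ∎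
  where
  open PermutationReasoning
  bottom : List ℕ
  bottom = sumsX zx 0 ++ sumsY zy 0 ++ sumsP zp 0
  6s+6≡6[1+s] : ∀ s → 6 * s + 6 ≡ 6 * suc s
  6s+6≡6[1+s] = solve-∀

width : ℕ → ℕ
width s = 3 * s + 4

-- The cycle climbs ladderX and descends ladderY; its junction edge hi (3s + 3), lo (3s + 3)
-- has index sum 6s + 6 and the path's attaching edge lo (3s + 5), hi (3s + 2) has 6s + 7.
core : ℕ → List Vertex
core s = reverse (ladderX [] s) ++ ladderY [ hi 1 ] s

length-core : ∀ s → length (core s) ≡ 4 * s + 3
length-core s = begin
  length (reverse (ladderX [] s) ++ ladderY [ hi 1 ] s)              ≡⟨ length-++ (reverse (ladderX [] s)) ⟩
  length (reverse (ladderX [] s)) + length (ladderY [ hi 1 ] s)      ≡⟨ cong (_+ length (ladderY [ hi 1 ] s)) (length-reverse (ladderX [] s)) ⟩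
  suc (length (rungsX [] s)) + suc (length (rungsY [ hi 1 ] s))      ≡⟨ cong₂ (λ m n → suc m + suc n) (length-rungsX [] s) (length-rungsY [ hi 1 ] s) ⟩
  suc (2 * s + 0) + suc (2 * s + 1)                                   ≡⟨ arithmetic s ⟩
  4 * s + 3                                                           ∎
  where
  open ≡-Reasoning
  arithmetic : ∀ s → suc (2 * s + 0) + suc (2 * s + 1) ≡ 4 * s + 3
  arithmetic = solve-∀

coreEdges : ℕ → Vertex → List (Vertex × Vertex)
coreEdges s w = map swap (edgesAlong (ladderX [ lo 2 ] s)) ++ (hi (3 * s + 3) , lo (3 * s + 3)) ∷ edgesAlong (ladderY (hi 1 ∷ w ∷ []) s)

edgesAlong-core : ∀ s w → edgesAlong (lo 2 ∷ core s ++ [ w ]) ↭ coreEdges s w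
edgesAlong-core s w = ↭-trans (↭-reflexive (cong edgesAlong unfolded))
  (edgesAlong-reverse-++ (hi (3 * s + 3)) (rungsX [ lo 2 ] s) (lo (3 * s + 3)) (rungsY (hi 1 ∷ w ∷ []) s))
  where
  open ≡-Reasoning
  unfolded : lo 2 ∷ core s ++ [ w ] ≡ reverse (ladderX [ lo 2 ] s) ++ ladderY (hi 1 ∷ w ∷ []) s
  unfolded = begin
    lo 2 ∷ (reverse (ladderX [] s) ++ ladderY [ hi 1 ] s) ++ [ w ]
      ≡⟨ cong (lo 2 ∷_) (++-assoc (reverse (ladderX [] s)) (ladderY [ hi 1 ] s) [ w ]) ⟩
    lo 2 ∷ reverse (ladderX [] s) ++ lo (3 * s + 3) ∷ rungsY [ hi 1 ] s ++ [ w ]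
      ≡⟨ cong (λ u → lo 2 ∷ reverse (ladderX [] s) ++ lo (3 * s + 3) ∷ u) (rungsY-++ [ hi 1 ] [ w ] s) ⟩
    (lo 2 ∷ reverse (ladderX [] s)) ++ ladderY (hi 1 ∷ w ∷ []) s
      ≡⟨ cong (_++ ladderY (hi 1 ∷ w ∷ []) s) (reverse-++ (ladderX [] s) [ lo 2 ]) ⟨
    reverse (ladderX [] s ++ [ lo 2 ]) ++ ladderY (hi 1 ∷ w ∷ []) s
      ≡⟨ cong (λ u → reverse (hi (3 * s + 3) ∷ u) ++ ladderY (hi 1 ∷ w ∷ []) s) (rungsX-++ [] [ lo 2 ] s) ⟩
    reverse (ladderX [ lo 2 ] s) ++ ladderY (hi 1 ∷ w ∷ []) s ∎

mixed-coreEdges : ∀ s i → All Mixed (coreEdges s (lo i))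
mixed-coreEdges s i = All.++⁺ (All.map⁺ (All.map (λ {t} → mixed-swap t) (mixed-ladderX [ lo 2 ] s (tt ∷ []))))
                              (tt ∷ mixed-ladderY (hi 1 ∷ lo i ∷ []) s (tt ∷ tt ∷ []))

cycle-vertices : ∀ s zp (pre : List Vertex) →
                 pre ++ ladderX [] 0 ++ ladderY [ hi 1 ] 0 ++ ladderP zp 0 ↭ loHi 0 4 →
                 pre ++ core s ++ ladderP zp s ↭ freshVertices (width s) (width s)
cycle-vertices s zp pre bottom↭ = begin
  pre ++ (reverse (ladderX [] s) ++ ladderY [ hi 1 ] s) ++ ladderP zp s
    ≡⟨ cong (pre ++_) (++-assoc (reverse (ladderX [] s)) _ _) ⟩
  pre ++ reverse (ladderX [] s) ++ ladderY [ hi 1 ] s ++ ladderP zp s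
    ↭⟨ ++⁺ˡ pre (++⁺ʳ _ (↭-reverse (ladderX [] s))) ⟩
  pre ++ ladderX [] s ++ ladderY [ hi 1 ] s ++ ladderP zp s
    ↭⟨ ++⁺ˡ pre (ladder-vertices [] [ hi 1 ] zp s) ⟩
  pre ++ (ladderX [] 0 ++ ladderY [ hi 1 ] 0 ++ ladderP zp 0) ++ loHi 4 (3 * s)
    ≡⟨ ++-assoc pre _ _ ⟨
  (pre ++ ladderX [] 0 ++ ladderY [ hi 1 ] 0 ++ ladderP zp 0) ++ loHi 4 (3 * s)
    ↭⟨ ++⁺ʳ _ bottom↭ ⟩
  loHi 0 4 ++ loHi 4 (3 * s)
    ↭⟨ loHi-++ 0 4 (3 * s) ⟨
  loHi 0 (4 + 3 * s)
    ≡⟨ cong (loHi 0) (+-comm 4 (3 * s)) ⟩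
  freshVertices (width s) (width s) ∎
  where open PermutationReasoning

cycle-sums : ∀ s w zp (pre : List ℕ) →
             pre ++ sumsX [ lo 2 ] 0 ++ sumsY (hi 1 ∷ w ∷ []) 0 ++ sumsP zp 0 ↭ range 0 6 →
             pre ++ map indexSum (coreEdges s w ++ (lo (width s + 1) , hi (3 * s + 2)) ∷ edgesAlong (ladderP zp s)) ↭
             range 0 (width s + width s)
cycle-sums s w zp pre bottom↭ = begin
  pre ++ map indexSum ((map swap (edgesAlong (ladderX [ lo 2 ] s)) ++ junction ∷ edgesAlong (ladderY (hi 1 ∷ w ∷ []) s)) ++
                       attachment ∷ edgesAlong (ladderP zp s))
    ≡⟨ cong (pre ++_) sums-unfold ⟩
  pre ++ (sumsX [ lo 2 ] s ++ indexSum junction ∷ sumsY (hi 1 ∷ w ∷ []) s) ++ indexSum attachment ∷ sumsP zp s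
    ↭⟨ ++⁺ˡ pre pull-two ⟩
  pre ++ indexSum junction ∷ indexSum attachment ∷ (sumsX [ lo 2 ] s ++ sumsY (hi 1 ∷ w ∷ []) s ++ sumsP zp s)
    ↭⟨ ++⁺ˡ pre (↭-prep _ (↭-prep _ (ladder-sums [ lo 2 ] (hi 1 ∷ w ∷ []) zp s))) ⟩
  pre ++ indexSum junction ∷ indexSum attachment ∷ (bottom ++ range 6 (6 * s))
    ↭⟨ shifts pre (indexSum junction ∷ indexSum attachment ∷ []) ⟩
  indexSum junction ∷ indexSum attachment ∷ pre ++ bottom ++ range 6 (6 * s)
    ≡⟨ cong₂ (λ j v → j ∷ v ∷ pre ++ bottom ++ range 6 (6 * s)) (junction≡ s) (attachment≡ s) ⟩
  range (6 + 6 * s) 2 ++ pre ++ bottom ++ range 6 (6 * s)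
    ↭⟨ ↭-++-comm (range (6 + 6 * s) 2) _ ⟩
  (pre ++ bottom ++ range 6 (6 * s)) ++ range (6 + 6 * s) 2
    ≡⟨ cong (_++ range (6 + 6 * s) 2) (++-assoc pre bottom _) ⟨
  ((pre ++ bottom) ++ range 6 (6 * s)) ++ range (6 + 6 * s) 2
    ↭⟨ ++⁺ʳ _ (++⁺ʳ _ bottom↭) ⟩
  (range 0 6 ++ range 6 (6 * s)) ++ range (6 + 6 * s) 2
    ≡⟨ cong (_++ range (6 + 6 * s) 2) (range-++ 0 6 (6 * s)) ⟨
  range 0 (6 + 6 * s) ++ range (6 + 6 * s) 2
    ≡⟨ range-++ 0 (6 + 6 * s) 2 ⟨
  range 0 (6 + 6 * s + 2)
    ≡⟨ cong (range 0) (total s) ⟩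
  range 0 (width s + width s) ∎
  where
  open PermutationReasoning
  junction attachment : Vertex × Vertex
  junction   = hi (3 * s + 3) , lo (3 * s + 3)
  attachment = lo (width s + 1) , hi (3 * s + 2)
  bottom : List ℕ
  bottom = sumsX [ lo 2 ] 0 ++ sumsY (hi 1 ∷ w ∷ []) 0 ++ sumsP zp 0
  sums-unfold : map indexSum ((map swap (edgesAlong (ladderX [ lo 2 ] s)) ++ junction ∷ edgesAlong (ladderY (hi 1 ∷ w ∷ []) s)) ++
                              attachment ∷ edgesAlong (ladderP zp s))
              ≡ (sumsX [ lo 2 ] s ++ indexSum junction ∷ sumsY (hi 1 ∷ w ∷ []) s) ++ indexSum attachment ∷ sumsP zp s
  sums-unfold = trans (map-++ indexSum (map swap (edgesAlong (ladderX [ lo 2 ] s)) ++ _) _)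
    (cong (_++ indexSum attachment ∷ sumsP zp s)
      (trans (map-++ indexSum (map swap (edgesAlong (ladderX [ lo 2 ] s))) _)
             (cong (_++ indexSum junction ∷ sumsY (hi 1 ∷ w ∷ []) s) (map-map-cong indexSum-swap _))))
  pull-two : (sumsX [ lo 2 ] s ++ indexSum junction ∷ sumsY (hi 1 ∷ w ∷ []) s) ++ indexSum attachment ∷ sumsP zp s ↭
             indexSum junction ∷ indexSum attachment ∷ (sumsX [ lo 2 ] s ++ sumsY (hi 1 ∷ w ∷ []) s ++ sumsP zp s)
  pull-two = begin
    (xs ++ j ∷ ys) ++ v ∷ zs ≡⟨ ++-assoc xs (j ∷ ys) (v ∷ zs) ⟩
    xs ++ j ∷ ys ++ v ∷ zs   ↭⟨ shift j xs (ys ++ v ∷ zs) ⟩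
    j ∷ xs ++ ys ++ v ∷ zs   ↭⟨ ↭-prep j (++⁺ˡ xs (shift v ys zs)) ⟩
    j ∷ xs ++ v ∷ ys ++ zs   ↭⟨ ↭-prep j (shift v xs (ys ++ zs)) ⟩
    j ∷ v ∷ xs ++ ys ++ zs   ∎
    where
    xs ys zs : List ℕ
    xs = sumsX [ lo 2 ] s
    ys = sumsY (hi 1 ∷ w ∷ []) s
    zs = sumsP zp s
    j v : ℕ
    j = indexSum junction
    v = indexSum attachment
  junction≡ : ∀ s → 3 * s + 3 + (3 * s + 3) ≡ 6 + 6 * s
  junction≡ = solve-∀
  attachment≡ : ∀ s → 3 * s + 4 + 1 + (3 * s + 2) ≡ suc (6 + 6 * s)
  attachment≡ = solve-∀
  total : ∀ s → 6 + 6 * s + 2 ≡ 3 * s + 4 + (3 * s + 4)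
  total = solve-∀

oneCycleExtension : ∀ s (cycle path : List Vertex) ℓ →
                 length cycle ≡ ℓ →
                 cycle ++ path ↭ freshVertices (width s) (width s) →
                 map indexSum (edgesAround cycle ++ edgesAlong (lo (width s + 1) ∷ path)) ↭ range 0 (width s + width s) →
                 All Mixed (edgesAround cycle ++ edgesAlong (lo (width s + 1) ∷ path)) →
                 Extension (width s) (width s) [ ℓ ]
oneCycleExtension s cycle path ℓ length≡ vertices sums mixed = record
  { newCycles       = [ cycle ]
  ; newPath         = path
  ; newCycleLengths = cong [_] length≡
  ; vertices↭       = subst (λ c → c ++ path ↭ freshVertices (width s) (width s)) (sym (++-identityʳ cycle)) vertices
  ; indexSums↭      = subst (λ es → map indexSum (es ++ _) ↭ _) (sym (++-identityʳ (edgesAround cycle))) sums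
  ; mixed           = subst (λ es → All Mixed (es ++ _)) (sym (++-identityʳ (edgesAround cycle))) mixed
  }

cycleExtension-4s+4 : ∀ s → Extension (width s) (width s) [ 4 * s + 4 ]
cycleExtension-4s+4 s = oneCycleExtension s (lo 2 ∷ core s) (ladderP tail s) (4 * s + 4)
  (trans (cong suc (length-core s)) (sym (+-suc (4 * s) 3)))
  (cycle-vertices s tail [ lo 2 ] (decideⱽ↭ (Maybe.just tt)))
  (↭-trans (map⁺ indexSum edges↭) (cycle-sums s (lo 2) tail [] (decideᴺ↭ (Maybe.just tt))))
  (All-resp-↭ (↭-sym edges↭) (All.++⁺ (mixed-coreEdges s 2) (tt ∷ mixed-ladderP tail s (tt ∷ tt ∷ tt ∷ []))))
  where
  tail : List Vertex
  tail = lo 0 ∷ hi 0 ∷ lo 1 ∷ []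
  edges↭ : edgesAround (lo 2 ∷ core s) ++ edgesAlong (lo (width s + 1) ∷ ladderP tail s) ↭
           coreEdges s (lo 2) ++ edgesAlong (lo (width s + 1) ∷ ladderP tail s)
  edges↭ = ++⁺ʳ _ (edgesAlong-core s (lo 2))

cycleExtension-4s+6 : ∀ s → Extension (width s) (width s) [ 4 * s + 6 ]
cycleExtension-4s+6 s = oneCycleExtension s (lo 0 ∷ hi 0 ∷ lo 2 ∷ core s) (ladderP [ lo 1 ] s) (4 * s + 6)
  (trans (cong (3 +_) (length-core s)) (arithmetic s))
  (cycle-vertices s [ lo 1 ] (lo 0 ∷ hi 0 ∷ lo 2 ∷ []) (decideⱽ↭ (Maybe.just tt)))
  (↭-trans (map⁺ indexSum edges↭) (cycle-sums s (lo 0) [ lo 1 ] (0 ∷ 2 ∷ []) (decideᴺ↭ (Maybe.just tt))))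
  (All-resp-↭ (↭-sym edges↭) (tt ∷ tt ∷ All.++⁺ (mixed-coreEdges s 0) (tt ∷ mixed-ladderP [ lo 1 ] s (tt ∷ []))))
  where
  arithmetic : ∀ s → 3 + (4 * s + 3) ≡ 4 * s + 6
  arithmetic = solve-∀
  edges↭ : edgesAround (lo 0 ∷ hi 0 ∷ lo 2 ∷ core s) ++ edgesAlong (lo (width s + 1) ∷ ladderP [ lo 1 ] s) ↭
           ((lo 0 , hi 0) ∷ (hi 0 , lo 2) ∷ coreEdges s (lo 0)) ++ edgesAlong (lo (width s + 1) ∷ ladderP [ lo 1 ] s)
  edges↭ = ++⁺ʳ _ (↭-prep _ (↭-prep _ (edgesAlong-core s (lo 0))))

record Seed (L : List ℕ) (ε : ℕ) : Set where
  field
    half   : ℕ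
    alpha  : Alpha ε half L
    starts : StartsAtOne alpha
    odd    : ε ≡ suc (half + half)

open Seed

grow : ∀ {L ε p ℓs} → Seed L ε → (X : Extension p p ℓs) → EndsAtOne X → Seed (ℓs ++ L) (ε + (p + p))
grow {ε = ε} {p} S X (o , ends) = record
  { half   = half S + p
  ; alpha  = Extend.result (alpha S) (starts S) X
  ; starts = Extend.startsAtOne (alpha S) (starts S) X o ends
  ; odd    = trans (cong (_+ (p + p)) (odd S)) (arithmetic (half S) p)
  }
  where
  arithmetic : ∀ a p → suc (a + a) + (p + p) ≡ suc (a + p + (a + p))
  arithmetic = solve-∀

seed₃ : Seed [] 3
seed₃ = record { half = 1 ; alpha = initialPath ; starts = _ , refl ; odd = refl }

even>2⇒4k+4⊎4k+6 : ∀ ℓ → 2 ∣ ℓ → 2 < ℓ → (∃ λ k → ℓ ≡ 4 * k + 4) ⊎ (∃ λ k → ℓ ≡ 4 * k + 6)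
even>2⇒4k+4⊎4k+6 ℓ (divides q refl) 2<ℓ = halves q (2≤q q 2<ℓ)
  where
  2≤q : ∀ q → 2 < q * 2 → 2 ≤ q
  2≤q (suc (suc q)) _ = s≤s (s≤s z≤n)
  2≤q 1 (s≤s (s≤s ()))
  halves : ∀ q → 2 ≤ q → (∃ λ s → q * 2 ≡ 4 * s + 4) ⊎ (∃ λ s → q * 2 ≡ 4 * s + 6)
  halves 0 ()
  halves 1 (s≤s ())
  halves 2 _ = inj₁ (0 , refl)
  halves 3 _ = inj₂ (0 , refl)
  halves (suc (suc (suc (suc q)))) _ with halves (suc (suc q)) (s≤s (s≤s z≤n))
  ... | inj₁ (s , eq) = inj₁ (suc s , trans (cong (4 +_) eq) (step s))
    where
    step : ∀ s → 4 + (4 * s + 4) ≡ 4 * suc s + 4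
    step = solve-∀
  ... | inj₂ (s , eq) = inj₂ (suc s , trans (cong (4 +_) eq) (step s))
    where
    step : ∀ s → 4 + (4 * s + 6) ≡ 4 * suc s + 6
    step = solve-∀

cycle-cost-bound : ∀ ε₀ s ℓ L → 4 * s + 4 ≤ ℓ → 2 * ε₀ ≤ 6 + 3 * sum L + 4 * length L →
                   2 * (ε₀ + (width s + width s)) ≤ 6 + 3 * sum (ℓ ∷ L) + 4 * length (ℓ ∷ L)
cycle-cost-bound ε₀ s ℓ L 4s+4≤ℓ bound = begin
  2 * (ε₀ + (width s + width s))                  ≡⟨ e₁ ε₀ s ⟩
  2 * ε₀ + (3 * (4 * s + 4) + 4)                  ≤⟨ +-mono-≤ bound (+-monoˡ-≤ 4 (*-monoʳ-≤ 3 4s+4≤ℓ)) ⟩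
  (6 + 3 * sum L + 4 * length L) + (3 * ℓ + 4)    ≡⟨ e₂ (sum L) (length L) ℓ ⟩
  6 + 3 * (ℓ + sum L) + 4 * suc (length L)        ∎
  where
  open ≤-Reasoning
  e₁ : ∀ ε s → 2 * (ε + ((3 * s + 4) + (3 * s + 4))) ≡ 2 * ε + (3 * (4 * s + 4) + 4)
  e₁ = solve-∀
  e₂ : ∀ S n ℓ → (6 + 3 * S + 4 * n) + (3 * ℓ + 4) ≡ 6 + 3 * (ℓ + S) + 4 * suc n
  e₂ = solve-∀

cyclePhase : ∀ L → All (λ ℓ → 2 ∣ ℓ × ℓ > 2) L → Σ ℕ λ ε₀ → Seed L ε₀ × 2 * ε₀ ≤ 6 + 3 * sum L + 4 * length L
cyclePhase []      _                     = 3 , seed₃ , ≤-refl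
cyclePhase (ℓ ∷ L) ((2∣ℓ , 2<ℓ) ∷ ok) with even>2⇒4k+4⊎4k+6 ℓ 2∣ℓ 2<ℓ | cyclePhase L ok
... | inj₁ (s , refl) | ε₀ , S , bound =
  ε₀ + (width s + width s) , grow S (cycleExtension-4s+4 s) (ladderP (lo 0 ∷ hi 0 ∷ []) s , ladderP-ends (lo 0 ∷ hi 0 ∷ []) s) ,
  cycle-cost-bound ε₀ s (4 * s + 4) L ≤-refl bound
... | inj₂ (s , refl) | ε₀ , S , bound =
  ε₀ + (width s + width s) , grow S (cycleExtension-4s+6 s) (ladderP [] s , ladderP-ends [] s) ,
  cycle-cost-bound ε₀ s (4 * s + 6) L (+-monoʳ-≤ (4 * s) (m≤n+m 4 2)) bound

record Growing (L : List ℕ) (c ε : ℕ) : Set where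
  field
    seed   : Seed L ε
    covers : PathCovers c (alpha seed)

record Finished (L : List ℕ) (c ε : ℕ) : Set where
  field
    split     : ℕ
    labelling : Alpha ε split L
    balanced  : ε ≡ suc (split + split) ⊎ ε ≡ suc (suc (split + split))
    covers    : PathCovers c labelling

start : ∀ {L ε₀} → Seed L ε₀ → Growing L ε₀ ε₀
start S = record { seed = S ; covers = λ d ε₀<d d≤ε₀ → ⊥-elim (<-irrefl refl (<-≤-trans ε₀<d d≤ε₀)) }

lengthen : ∀ {L c ε p} → Growing L c ε → (X : Extension p p []) → newCycles X ≡ [] → EndsAtOne X → Growing L c (ε + (p + p))
lengthen {c = c} G X noCycles ends = record
  { seed   = grow S X ends
  ; covers = Extend.pathCovers (alpha S) (starts S) X noCycles c (Growing.covers G)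
  }
  where
  S : Seed _ _
  S = Growing.seed G

lengthen-4* : ∀ {L c ε} k → Growing L c ε → Growing L c (ε + 4 * k)
lengthen-4* {L} {c} {ε} zero    G = subst (Growing L c) (sym (+-identityʳ ε)) G
lengthen-4* {L} {c} {ε} (suc k) G =
  subst (Growing L c) (arithmetic ε k) (lengthen (lengthen-4* k G) pathExtension₄ refl (hi 0 ∷ lo 0 ∷ hi 1 ∷ [] , refl))
  where
  arithmetic : ∀ ε k → ε + 4 * k + (2 + 2) ≡ ε + 4 * suc k
  arithmetic = solve-∀

lengthen-6 : ∀ {L c ε} → Growing L c ε → Growing L c (ε + 6)
lengthen-6 G = lengthen G pathExtension₆ refl (hi 1 ∷ lo 0 ∷ hi 0 ∷ lo 2 ∷ hi 2 ∷ [] , refl)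

finish : ∀ {L c ε} → Growing L c ε → Finished L c ε
finish G = record
  { split = half S ; labelling = alpha S ; balanced = inj₁ (odd S) ; covers = Growing.covers G }
  where
  S : Seed _ _
  S = Growing.seed G

finish-3 : ∀ {L c ε} → Growing L c ε → Finished L c (ε + 3)
finish-3 {c = c} {ε} G = record
  { split     = half S + 1
  ; labelling = Extend.result (alpha S) (starts S) pathExtension₃
  ; balanced  = inj₂ (trans (cong (_+ 3) (odd S)) (arithmetic (half S)))
  ; covers    = Extend.pathCovers (alpha S) (starts S) pathExtension₃ refl c (Growing.covers G)
  }
  where
  S : Seed _ _
  S = Growing.seed G
  arithmetic : ∀ a → suc (a + a) + 3 ≡ suc (suc (a + 1 + (a + 1)))
  arithmetic = solve-∀

-- Extensions by 4 and 6 keep ε odd, a last one by 3 makes it even: ε₀ + 9, ε₀ + 10,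
-- ε₀ + 11 and ε₀ + 12 are 6 + 3, 4 + 6, 8 + 3 and 12 beyond ε₀.
reach : ∀ {L c ε₀} → Growing L c ε₀ → ∀ ε → ε₀ + 9 ≤ ε → Finished L c ε
reach {L} {c} {ε₀} G ε ε₀+9≤ε with m≤n⇒∃[o]m+o≡n ε₀+9≤ε
... | t , refl with t % 4 | m≡m%n+[m/n]*n t 4 | m%n<n t 4
... | 0 | t≡ | _ = subst (Finished L c) (trans (e₀ ε₀ (t / 4)) (cong (ε₀ + 9 +_) (sym t≡)))
                          (finish-3 (lengthen-6 (lengthen-4* (t / 4) G)))
  where
  e₀ : ∀ ε k → ε + 4 * k + 6 + 3 ≡ ε + 9 + (0 + k * 4)
  e₀ = solve-∀
... | 1 | t≡ | _ = subst (Finished L c) (trans (e₁ ε₀ (t / 4)) (cong (ε₀ + 9 +_) (sym t≡)))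
                          (finish (lengthen-6 (lengthen-4* (suc (t / 4)) G)))
  where
  e₁ : ∀ ε k → ε + 4 * suc k + 6 ≡ ε + 9 + (1 + k * 4)
  e₁ = solve-∀
... | 2 | t≡ | _ = subst (Finished L c) (trans (e₂ ε₀ (t / 4)) (cong (ε₀ + 9 +_) (sym t≡)))
                          (finish-3 (lengthen-4* (2 + t / 4) G))
  where
  e₂ : ∀ ε k → ε + 4 * (2 + k) + 3 ≡ ε + 9 + (2 + k * 4)
  e₂ = solve-∀
... | 3 | t≡ | _ = subst (Finished L c) (trans (e₃ ε₀ (t / 4)) (cong (ε₀ + 9 +_) (sym t≡)))
                          (finish (lengthen-4* (3 + t / 4) G))
  where
  e₃ : ∀ ε k → ε + 4 * (3 + k) ≡ ε + 9 + (3 + k * 4)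
  e₃ = solve-∀
... | suc (suc (suc (suc _))) | _ | s≤s (s≤s (s≤s (s≤s ())))

±_ : ℕ → List ℤ
± k = ℤ.+ k ∷ ℤ.- (ℤ.+ k) ∷ []

+x-+y≡+∣x-y∣ : ∀ {x y} → y ≤ x → ℤ.+ x ℤ.- ℤ.+ y ≡ ℤ.+ ∣ x - y ∣
+x-+y≡+∣x-y∣ {x} {y} y≤x = trans (ℤₚ.[+m]-[+n]≡m⊖n x y) (trans (ℤₚ.⊖-≥ y≤x) (cong ℤ.+_ (sym (m≤n⇒∣n-m∣≡n∸m y≤x))))

+x-+y≡-∣y-x∣ : ∀ {x y} → x ≤ y → ℤ.+ x ℤ.- ℤ.+ y ≡ ℤ.- ℤ.+ ∣ y - x ∣
+x-+y≡-∣y-x∣ {x} {y} x≤y = trans (ℤₚ.[+m]-[+n]≡m⊖n x y) (trans (ℤₚ.⊖-≤ x≤y) (cong (λ d → ℤ.- ℤ.+ d) (sym (m≤n⇒∣n-m∣≡n∸m x≤y))))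

Δ-edge↭ : ∀ x y → (ℤ.+ x ℤ.- ℤ.+ y) ∷ (ℤ.+ y ℤ.- ℤ.+ x) ∷ [] ↭ ± edgeLength (x , y)
Δ-edge↭ x y with ≤-total y x
... | inj₁ y≤x = ↭-reflexive (cong₂ (λ u v → u ∷ v ∷ []) (+x-+y≡+∣x-y∣ y≤x) (+x-+y≡-∣y-x∣ y≤x))
... | inj₂ x≤y = ↭-trans (↭-reflexive (cong₂ (λ u v → u ∷ v ∷ []) (+x-+y≡-∣y-x∣ x≤y) (+x-+y≡+∣x-y∣ x≤y)))
                         (↭-trans (↭-swap _ _ ↭-refl) (↭-reflexive (cong ±_ (∣-∣-comm y x))))

Δ↭ : ∀ es → Δ es ↭ concatMap ±_ (map edgeLength es)
Δ↭ []             = ↭-refl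
Δ↭ ((x , y) ∷ es) = ++⁺ (Δ-edge↭ x y) (Δ↭ es)

∈-Δ : ∀ es {d} → d ∈ map edgeLength es → ℤ.+ d ∈ Δ es
∈-Δ ((x , y) ∷ es) (here refl) = ∈-++⁺ˡ (∈-resp-↭ (↭-sym (Δ-edge↭ x y)) (here refl))
∈-Δ ((x , y) ∷ es) (there d∈)  = there (there (∈-Δ es d∈))

[2+n]/2≡1+n/2 : ∀ n → (2 + n) / 2 ≡ suc (n / 2)
[2+n]/2≡1+n/2 n = m/n≡1+[m∸n]/n {2 + n} {2} (s≤s (s≤s z≤n))

[a+a]/2≡a : ∀ a → (a + a) / 2 ≡ a
[a+a]/2≡a zero    = refl
[a+a]/2≡a (suc a) = trans (cong (λ n → suc n / 2) (+-suc a a)) (trans ([2+n]/2≡1+n/2 (a + a)) (cong suc ([a+a]/2≡a a)))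

[1+a+a]/2≡a : ∀ a → suc (a + a) / 2 ≡ a
[1+a+a]/2≡a zero    = refl
[1+a+a]/2≡a (suc a) = trans (cong (λ n → suc (suc n) / 2) (+-suc a a)) (trans ([2+n]/2≡1+n/2 (suc (a + a))) (cong suc ([1+a+a]/2≡a a)))

balanced-sides : ∀ ε a → ε ≡ suc (a + a) ⊎ ε ≡ suc (suc (a + a)) → (ε ∸ 1) / 2 ≡ a × suc ε / 2 ≡ suc a
balanced-sides _ a (inj₁ refl) = [a+a]/2≡a a , trans ([2+n]/2≡1+n/2 (a + a)) (cong suc ([a+a]/2≡a a))
balanced-sides _ a (inj₂ refl) = [1+a+a]/2≡a a , trans ([2+n]/2≡1+n/2 (suc (a + a))) (cong suc ([1+a+a]/2≡a a))

straddles⇒joinsSides : ∀ {ε a} → (ε ∸ 1) / 2 ≡ a → suc ε / 2 ≡ suc a → ∀ e → Straddles a e → JoinsSides ε e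
straddles⇒joinsSides low high (x , y) (inj₁ (x≤a , a<y)) = inj₁ (subst (x ≤_) (sym low) x≤a , subst (_≤ y) (sym high) a<y)
straddles⇒joinsSides low high (x , y) (inj₂ (y≤a , a<x)) = inj₂ (subst (y ≤_) (sym low) y≤a , subst (_≤ x) (sym high) a<x)

module _ {ε a L} (S : Alpha ε a L) where

  vertex-count : sum L + length (pathLabels S) ≡ suc ε
  vertex-count = begin
    sum L + length (pathLabels S)                          ≡⟨ cong (_+ length (pathLabels S)) cycle-vertex-count ⟨
    length (concat (cycleLabels S)) + length (pathLabels S) ≡⟨ length-++ (concat (cycleLabels S)) ⟨
    length (concat (cycleLabels S) ++ pathLabels S)        ≡⟨ ↭-length (labels↭ S) ⟩
    length (range 0 (suc ε))                               ≡⟨ length-range 0 (suc ε) ⟩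
    suc ε                                                  ∎
    where
    open ≡-Reasoning
    cycle-vertex-count : length (concat (cycleLabels S)) ≡ sum L
    cycle-vertex-count = trans (length-concat (cycleLabels S)) (cong sum (cycleLengths S))

  edge-count : sum L + length (edgesAlong (pathLabels S)) ≡ ε
  edge-count = begin
    sum L + length (edgesAlong (pathLabels S))                                     ≡⟨ cong (_+ _) cycle-edge-count ⟨
    length (concatMap edgesAround (cycleLabels S)) + length (edgesAlong (pathLabels S)) ≡⟨ length-++ (concatMap edgesAround (cycleLabels S)) ⟨
    length (edgesOf (cycleLabels S) (pathLabels S))                               ≡⟨ length-map edgeLength (edgesOf (cycleLabels S) (pathLabels S)) ⟨
    length (map edgeLength (edgesOf (cycleLabels S) (pathLabels S)))              ≡⟨ ↭-length (edgeLengths↭ S) ⟩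
    length (range 1 ε)                                                             ≡⟨ length-range 1 ε ⟩
    ε                                                                              ∎
    where
    open ≡-Reasoning
    cycle-edge-count : length (concatMap edgesAround (cycleLabels S)) ≡ sum L
    cycle-edge-count = trans (length-concatMap-edgesAround (cycleLabels S)) (cong sum (cycleLengths S))

  path-length : length (pathLabels S) ≡ suc (ε ∸ sum L) × sum L + (ε ∸ sum L) ≡ ε
  path-length with pathLabels S | vertex-count | edge-count
  ... | []     | vertices | edges = ⊥-elim (1+n≢n (trans (sym vertices) edges))
  ... | y ∷ ys | vertices | edges = cong suc (sym ε∸sumL≡) , trans (cong (sum L +_) ε∸sumL≡) path-edges
    where
    path-edges : sum L + length ys ≡ ε
    path-edges = trans (cong (sum L +_) (sym (length-edgesAlong y ys))) edges
    ε∸sumL≡ : ε ∸ sum L ≡ length ys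
    ε∸sumL≡ = trans (cong (_∸ sum L) (sym path-edges)) (m+n∸m≡n (sum L) (length ys))

toLabeling : ∀ {L c ε} → Finished L c ε →
             Σ (Labeling L (ε ∸ sum L)) λ Γ → IsαLabeling Γ × (∀ x → c < x → x ≤ ε → ℤ.+ x ∈ Δp Γ)
toLabeling {L} {c} {ε} F = Γ , isα , covered
  where
  S : Alpha ε (Finished.split F) L
  S = Finished.labelling F
  Γ : Labeling L (ε ∸ sum L)
  Γ = record { cycles = cycleLabels S ; cycleLens = cycleLengths S ; path = pathLabels S ; pathLen = proj₁ (path-length S) }
  total : sum L + (ε ∸ sum L) ≡ ε
  total = proj₂ (path-length S)
  edges≡ : Labeling.edges Γ ≡ edgesOf (cycleLabels S) (pathLabels S)
  edges≡ = cong₂ _++_ (concatMap-cong cycleEdges≡edgesAround (cycleLabels S)) (consecutive≡edgesAlong (pathLabels S))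
  sides : (ε ∸ 1) / 2 ≡ Finished.split F × suc ε / 2 ≡ suc (Finished.split F)
  sides = balanced-sides ε (Finished.split F) (Finished.balanced F)
  isα : IsαLabeling Γ
  isα = record
    { vertexSet   = subst (λ n → vertices Γ ↭ Iℕ 0 n) (sym total)
                      (subst (vertices Γ ↭_) (sym (Iℕ≡range 0 ε)) (labels↭ S))
    ; bipartite   = subst (λ n → All (JoinsSides n) (Labeling.edges Γ)) (sym total)
                      (subst (All (JoinsSides ε)) (sym edges≡)
                        (All.map (λ {e} → straddles⇒joinsSides {ε} (proj₁ sides) (proj₂ sides) e) (straddles S)))
    ; differences = subst (λ n → ΔΓ Γ ↭ pmI n) (sym total) (subst (λ es → Δ es ↭ pmI ε) (sym edges≡) (begin
        Δ (edgesOf (cycleLabels S) (pathLabels S))                        ↭⟨ Δ↭ (edgesOf (cycleLabels S) (pathLabels S)) ⟩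
        concatMap ±_ (map edgeLength (edgesOf (cycleLabels S) (pathLabels S))) ↭⟨ concatMap⁺ ±_ (edgeLengths↭ S) ⟩
        concatMap ±_ (range 1 ε)                                           ≡⟨ cong (concatMap ±_) (Iℕ≡range 1 ε) ⟨
        pmI ε                                                              ∎))
    }
    where open PermutationReasoning
  covered : ∀ x → c < x → x ≤ ε → ℤ.+ x ∈ Δp Γ
  covered x c<x x≤ε = subst (λ es → ℤ.+ x ∈ Δ es) (sym (consecutive≡edgesAlong (pathLabels S)))
                        (∈-Δ (edgesAlong (pathLabels S)) (Finished.covers F x c<x x≤ε))

sum≤length*max : ∀ L → sum L ≤ length L * maxL L
sum≤length*max []      = z≤n
sum≤length*max (ℓ ∷ L) =
  +-mono-≤ (m≤m⊔n ℓ (maxL L)) (≤-trans (sum≤length*max L) (*-monoʳ-≤ (length L) (m≤n⊔m ℓ (maxL L))))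

room-after-cycles : ∀ n M ε₀ ε → 3 ≤ M → 2 * ε₀ ≤ 6 + 3 * (suc n * M) + 4 * suc n →
                    2 * (suc n + 1) * (M + 3) ≤ ε + 1 → ε₀ + 9 ≤ ε
room-after-cycles n M ε₀ ε 3≤M size room with m≤n⇒∃[o]m+o≡n 3≤M
... | M′ , refl = *-cancelˡ-≤ 2 (+-cancelʳ-≤ 2 _ _ (begin
  2 * (ε₀ + 9) + 2                                          ≡⟨ e₁ ε₀ ⟩
  2 * ε₀ + 20                                               ≤⟨ +-monoˡ-≤ 20 size ⟩
  6 + 3 * (suc n * (3 + M′)) + 4 * suc n + 20               ≤⟨ m≤m+n _ (n * M′ + 11 * n + 5 * M′ + 9) ⟩
  6 + 3 * (suc n * (3 + M′)) + 4 * suc n + 20 + (n * M′ + 11 * n + 5 * M′ + 9) ≡⟨ e₂ n M′ ⟩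
  2 * (2 * (suc n + 1) * (3 + M′ + 3))                      ≤⟨ *-monoʳ-≤ 2 room ⟩
  2 * (ε + 1)                                               ≡⟨ e₃ ε ⟩
  2 * ε + 2                                                 ∎))
  where
  open ≤-Reasoning
  e₁ : ∀ x → 2 * (x + 9) + 2 ≡ 2 * x + 20
  e₁ = solve-∀
  e₂ : ∀ n M → 6 + 3 * (suc n * (3 + M)) + 4 * suc n + 20 + (n * M + 11 * n + 5 * M + 9) ≡ 2 * (2 * (suc n + 1) * (3 + M + 3))
  e₂ = solve-∀
  e₃ : ∀ x → 2 * (x + 1) ≡ 2 * x + 2
  e₃ = solve-∀

cycles-below : ∀ n M ε₀ → 3 ≤ M → 2 * ε₀ ≤ 6 + 3 * (suc n * M) + 4 * suc n → ε₀ < 2 * suc n * (M + 3)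
cycles-below n M ε₀ 3≤M size with m≤n⇒∃[o]m+o≡n 3≤M
... | M′ , refl = *-cancelˡ-≤ 2 (begin
  2 * suc ε₀                                                ≡⟨ e₁ ε₀ ⟩
  2 * ε₀ + 2                                                ≤⟨ +-monoˡ-≤ 2 size ⟩
  6 + 3 * (suc n * (3 + M′)) + 4 * suc n + 2                ≤⟨ m≤m+n _ (n * M′ + 11 * n + M′ + 3) ⟩
  6 + 3 * (suc n * (3 + M′)) + 4 * suc n + 2 + (n * M′ + 11 * n + M′ + 3) ≡⟨ e₂ n M′ ⟩
  2 * (2 * suc n * (3 + M′ + 3))                            ∎)
  where
  open ≤-Reasoning
  e₁ : ∀ x → 2 * suc x ≡ 2 * x + 2
  e₁ = solve-∀
  e₂ : ∀ n M → 6 + 3 * (suc n * (3 + M)) + 4 * suc n + 2 + (n * M + 11 * n + M + 3) ≡ 2 * (2 * suc n * (3 + M + 3))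
  e₂ = solve-∀

-- Opened only here: an unqualified +_ makes the sections (p +_) above ambiguous.
open import Data.Integer using (+_)

theorem4p8 : (L : List ℕ) → L ≢ [] → All (λ ℓ → 2 ∣ ℓ × ℓ > 2) L →
    (ε : ℕ) → 2 * (length L + 1) * (maxL L + 3) ≤ ε + 1 →
    Σ (Labeling L (ε ∸ sum L)) λ Γ → IsαLabeling Γ ×
    (∀ x → 2 * length L * (maxL L + 3) ≤ x → x ≤ ε → (+ x) ∈ Δp Γ)
theorem4p8 []      L≢[] _  ε room = ⊥-elim (L≢[] refl)
theorem4p8 (ℓ ∷ L) _    ok ε room = Γ , isα , λ x big x≤ε → covered x (<-≤-trans below big) x≤ε
  where
  M : ℕ
  M = maxL (ℓ ∷ L)
  3≤M : 3 ≤ M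
  3≤M = ≤-trans (proj₂ (All.head ok)) (m≤m⊔n ℓ (maxL L))
  phase : Σ ℕ λ ε₀ → Seed (ℓ ∷ L) ε₀ × 2 * ε₀ ≤ 6 + 3 * sum (ℓ ∷ L) + 4 * length (ℓ ∷ L)
  phase = cyclePhase (ℓ ∷ L) ok
  ε₀ : ℕ
  ε₀ = proj₁ phase
  size : 2 * ε₀ ≤ 6 + 3 * (suc (length L) * M) + 4 * suc (length L)
  size = ≤-trans (proj₂ (proj₂ phase)) (+-monoˡ-≤ (4 * suc (length L)) (+-monoʳ-≤ 6 (*-monoʳ-≤ 3 (sum≤length*max (ℓ ∷ L)))))
  below : ε₀ < 2 * suc (length L) * (M + 3)
  below = cycles-below (length L) M ε₀ 3≤M size
  labelling : Σ (Labeling (ℓ ∷ L) (ε ∸ sum (ℓ ∷ L))) λ Γ → IsαLabeling Γ × (∀ x → ε₀ < x → x ≤ ε → + x ∈ Δp Γ)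
  labelling = toLabeling (reach (start (proj₁ (proj₂ phase))) ε (room-after-cycles (length L) M ε₀ ε 3≤M size room))
  Γ : Labeling (ℓ ∷ L) (ε ∸ sum (ℓ ∷ L))
  Γ = proj₁ labelling
  isα : IsαLabeling Γ
  isα = proj₁ (proj₂ labelling)
  covered : ∀ x → ε₀ < x → x ≤ ε → + x ∈ Δp Γ
  covered = proj₂ (proj₂ labelling)
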